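{- Let $D=d_1,\dots,d_n$ be a tree degree sequence, let $n>m>2$, let $V=\{v_1,\dots,v_n\}$, $U=\{v_i : d_i>1\}$ and $L=V\setminus U$. Suppose $V_1,\dots,V_{m-1}$ are pairwise disjoint subsets of $L$ with $|U|>1$ and $|V_j|>1$ for all $j$, and $d_i\le n-m$ for all $i$. Then there is a tree $T$ on $V$ realizing $D$ such that for every $j\in\{1,\dots,m-1\}$, the subgraph of $T$ induced on $U\cup V_j$ is a tree that is not a star.
   Context: A degree sequence $D=d_1,\dots,d_n$ is a tree degree sequence if every $d_i$ is a positive integer and $\sum_i d_i=2n-2$; a tree $T$ on $\{v_1,\dots,v_n\}$ realizes $D$ if $v_i$ has degree $d_i$ in $T$ for all $i$. A star is a tree in which one vertex is adjacent to all others. -}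

module Defs where

open import Data.Nat using (ℕ; _≤_; _<_; _+_)
open import Data.Fin using (Fin; zero; suc)
open import Data.Unit using () renaming (⊤ to Unit)
open import Data.Fin.Subset using (Subset; _∈_; _∉_; ⊤; ∣_∣; ∁)
open import Data.Bool using (Bool; true; false; T)
open import Data.Vec using (tabulate)
open import Data.List using (List; []; _∷_; length)
open import Data.List.Relation.Unary.All using (All)
open import Data.List.Relation.Unary.Unique.Propositional using (Unique)
open import Data.Product using (Σ; ∃; _×_; _,_)
open import Relation.Binary.PropositionalEquality using (_≡_)
open import Relation.Nullary using (¬_)

record SimpleGraph (n : ℕ) : Set where
  field
    adj    : Fin n → Fin n → Bool
    sym    : ∀ i j → adj i j ≡ adj j i
    irrefl : ∀ i → adj i i ≡ false
open SimpleGraph public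

Adj : ∀ {n} → SimpleGraph n → Fin n → Fin n → Set
Adj G i j = T (adj G i j)

degree : ∀ {n} → SimpleGraph n → Fin n → ℕ
degree G v = ∣ tabulate (adj G v) ∣

AdjChain : ∀ {n} → SimpleGraph n → List (Fin n) → Set
AdjChain G []           = Unit
AdjChain G (x ∷ [])     = Unit
AdjChain G (x ∷ y ∷ xs) = Adj G x y × AdjChain G (y ∷ xs)

last : ∀ {A : Set} → A → List A → A
last x []       = x
last x (y ∷ ys) = last y ys

WalkIn : ∀ {n} → SimpleGraph n → Subset n → Fin n → Fin n → Set
WalkIn {n} G S u v = Σ (List (Fin n)) λ xs →
  All (_∈ S) (u ∷ xs) × AdjChain G (u ∷ xs) × last u xs ≡ v

ConnectedOn : ∀ {n} → SimpleGraph n → Subset n → Set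
ConnectedOn G S = ∀ u v → u ∈ S → v ∈ S → WalkIn G S u v

CycleIn : ∀ {n} → SimpleGraph n → Subset n → Set
CycleIn {n} G S = Σ (Fin n) λ x → Σ (List (Fin n)) λ xs →
  2 ≤ length xs × Unique (x ∷ xs) × All (_∈ S) (x ∷ xs) ×
  AdjChain G (x ∷ xs) × Adj G (last x xs) x

IsTreeOn : ∀ {n} → SimpleGraph n → Subset n → Set
IsTreeOn {n} G S = (∃ λ (v : Fin n) → v ∈ S) × ConnectedOn G S × ¬ CycleIn G S

IsTree : ∀ {n} → SimpleGraph n → Set
IsTree G = IsTreeOn G ⊤

IsStarOn : ∀ {n} → SimpleGraph n → Subset n → Set
IsStarOn {n} G S = Σ (Fin n) λ c → c ∈ S × (∀ v → v ∈ S → ¬ (v ≡ c) → Adj G c v)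

sumF : ∀ {n} → (Fin n → ℕ) → ℕ
sumF {ℕ.zero}  d = 0
sumF {ℕ.suc n} d = d zero + sumF (λ i → d (suc i))

IsTreeDegreeSeq : ∀ {n} → (Fin n → ℕ) → Set
IsTreeDegreeSeq {n} d = (∀ i → 1 ≤ d i) × sumF d + 2 ≡ n + n

Realizes : ∀ {n} → SimpleGraph n → (Fin n → ℕ) → Set
Realizes G d = ∀ i → degree G i ≡ d i

innerSet : ∀ {n} → (Fin n → ℕ) → Subset n
innerSet d = tabulate (λ i → 1 Data.Nat.<ᵇ d i)
  where import Data.Nat

leafSet : ∀ {n} → (Fin n → ℕ) → Subset n
leafSet d = ∁ (innerSet d)

-- The tree is a caterpillar. Its spine is the set U of inner vertices in increasing order, from the
-- first one a to the last one r, and every leaf hangs from a spine vertex: a and r take d − 1 leaves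
-- each, every other spine vertex d − 2, and the degree sum 2n − 2 makes this exactly the |L| leaves.
-- For any set V of leaves the subgraph induced on U ∪ V is the spine with the leaves of V attached,
-- a tree, and it is no star once it contains two vertices at distance 3. If |U| ≥ 4 these are a and r.
-- Otherwise each V_j contributes two representatives, and the leaves are distributed so that the
-- first representatives hang from a, or from a or r when |U| = 3, and the second ones from r when
-- |U| = 2; a leaf at one end and the other end, or a leaf at a and a leaf at r, are then at distance 3.
-- There is room for this because d_i ≤ n − m forces d a, d r ≥ m when |U| = 2 and
-- d a + d r ≥ m + 1 when |U| = 3.
module Submission where

open import Defs hiding (sym)
open import Data.Nat hiding (_≟_)
open import Data.Nat.Properties hiding (_≟_; suc-injective)
open import Data.Nat.Tactic.RingSolver using (solve-∀)
import Data.Nat as ℕ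
open import Algebra.Properties.CommutativeSemigroup +-commutativeSemigroup using (interchange; x∙yz≈y∙xz)
open import Data.Bool using (Bool; true; false; T; not; _∧_; _∨_)
open import Data.Bool.Properties using (T-∧; T-∨; T-not-≡; ∨-comm)
open import Data.Fin using (Fin; zero; suc; toℕ; _≟_)
open import Data.Fin.Properties using (suc-injective; any?; toℕ-injective; toℕ<n)
open import Data.Fin.Subset using (Subset; _∈_; _⊆_; _∪_; _∩_; ∣_∣; Empty; ⊤)
open import Data.Fin.Subset.Properties using (∈⊤; x∈p∪q⁺; x∈p∩q⁺; x∈∁p⇒x∉p)
open import Data.Vec using (lookup; tabulate)
open import Data.Vec.Properties using (lookup⇒[]=; lookup∘tabulate; tabulate∘lookup)
open import Data.List using (List; []; _∷_)
open import Data.List.Relation.Unary.All using ([]; _∷_)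
import Data.List.Relation.Unary.All as All
open import Data.List.Relation.Unary.Any using (here; there)
open import Data.List.Membership.Propositional using () renaming (_∈_ to _∈ₗ_)
open import Data.List.Relation.Unary.AllPairs using (_∷_)
open import Data.List.Relation.Unary.Unique.Propositional using (Unique)
open import Data.Product using (Σ; ∃; _×_; _,_; proj₁; proj₂)
open import Data.Sum using (_⊎_; inj₁; inj₂)
open import Data.Empty using (⊥; ⊥-elim)
open import Data.Unit using (tt)
open import Function using (_∘_; Equivalence)
open import Relation.Binary using (tri<; tri≈; tri>)
open import Relation.Binary.PropositionalEquality
open import Relation.Nullary using (¬_; Dec; yes; no; does)
open import Relation.Nullary.Decidable using (T?; isYes; toWitness; fromWitness; ¬?; _×-dec_)

module Counting where

  open Equivalence using (to; from)

  private variable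
    n : ℕ
    P Q : Fin n → Bool
    x : Fin n

  bit : Bool → ℕ
  bit true  = 1
  bit false = 0

  count : (Fin n → Bool) → ℕ
  count {zero}  P = 0
  count {suc n} P = bit (P zero) + count (P ∘ suc)

  infix 4 _⊆ᵇ_
  infixr 6 _∩ᵇ_ _─ᵇ_
  infixr 5 _∪ᵇ_

  _⊆ᵇ_ : (Fin n → Bool) → (Fin n → Bool) → Set
  P ⊆ᵇ Q = ∀ x → T (P x) → T (Q x)

  -- Opaque, so that membership T ((P ∩ᵇ Q) x) keeps P, Q and x inferable.
  opaque
    _∩ᵇ_ _∪ᵇ_ _─ᵇ_ : (Fin n → Bool) → (Fin n → Bool) → Fin n → Bool
    (P ∩ᵇ Q) x = P x ∧ Q x
    (P ∪ᵇ Q) x = P x ∨ Q x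
    (P ─ᵇ Q) x = P x ∧ not (Q x)

    ⁅_⁆ᵇ : Fin n → Fin n → Bool
    ⁅ a ⁆ᵇ x = does (a ≟ x)

    ∩ᵇ⁺ : T (P x) → T (Q x) → T ((P ∩ᵇ Q) x)
    ∩ᵇ⁺ p q = from T-∧ (p , q)

    ∩ᵇ⁻ˡ : T ((P ∩ᵇ Q) x) → T (P x)
    ∩ᵇ⁻ˡ = proj₁ ∘ to T-∧

    ∩ᵇ⁻ʳ : T ((P ∩ᵇ Q) x) → T (Q x)
    ∩ᵇ⁻ʳ = proj₂ ∘ to T-∧

    ∪ᵇ⁺ˡ : T (P x) → T ((P ∪ᵇ Q) x)
    ∪ᵇ⁺ˡ = from T-∨ ∘ inj₁

    ∪ᵇ⁺ʳ : T (Q x) → T ((P ∪ᵇ Q) x)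
    ∪ᵇ⁺ʳ = from T-∨ ∘ inj₂

    ∪ᵇ⁻ : T ((P ∪ᵇ Q) x) → T (P x) ⊎ T (Q x)
    ∪ᵇ⁻ = to T-∨

    ─ᵇ⁺ : T (P x) → ¬ T (Q x) → T ((P ─ᵇ Q) x)
    ─ᵇ⁺ p ¬q = from T-∧ (p , from T-not-≡ (¬T⇒≡false ¬q))
      where
      ¬T⇒≡false : ∀ {b} → ¬ T b → b ≡ false
      ¬T⇒≡false {false} _ = refl
      ¬T⇒≡false {true}  f = ⊥-elim (f tt)

    ─ᵇ⁻ˡ : T ((P ─ᵇ Q) x) → T (P x)
    ─ᵇ⁻ˡ = proj₁ ∘ to T-∧

    ─ᵇ⁻ʳ : T ((P ─ᵇ Q) x) → ¬ T (Q x)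
    ─ᵇ⁻ʳ p q with to T-not-≡ (proj₂ (to T-∧ p))
    ... | q≡false = subst T q≡false q

    ∘-∩ᵇ : ∀ {m} (P Q : Fin n → Bool) (f : Fin m → Fin n) → (P ∩ᵇ Q) ∘ f ≡ (P ∘ f) ∩ᵇ (Q ∘ f)
    ∘-∩ᵇ P Q f = refl

    ⁅⁆ᵇ⁺ : ∀ {a x : Fin n} → a ≡ x → T (⁅ a ⁆ᵇ x)
    ⁅⁆ᵇ⁺ {a = a} {x} a≡x with a ≟ x
    ... | yes _   = tt
    ... | no a≢x = a≢x a≡x

    ⁅⁆ᵇ⁻ : ∀ {a x : Fin n} → T (⁅ a ⁆ᵇ x) → a ≡ x
    ⁅⁆ᵇ⁻ {a = a} {x} p with a ≟ x
    ... | yes a≡x = a≡x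

  ∁ᵇ : (Fin n → Bool) → Fin n → Bool
  ∁ᵇ P = (λ _ → true) ─ᵇ P

  ∁ᵇ⁺ : ¬ T (P x) → T (∁ᵇ P x)
  ∁ᵇ⁺ = ─ᵇ⁺ tt

  ∁ᵇ⁻ : T (∁ᵇ P x) → ¬ T (P x)
  ∁ᵇ⁻ = ─ᵇ⁻ʳ

  ∣tabulate∣≡count : (P : Fin n → Bool) → ∣ tabulate P ∣ ≡ count P
  ∣tabulate∣≡count {zero}  P = refl
  ∣tabulate∣≡count {suc n} P with P zero
  ... | true  = cong suc (∣tabulate∣≡count (P ∘ suc))
  ... | false = ∣tabulate∣≡count (P ∘ suc)

  bit-true : ∀ {a} → T a → bit a ≡ 1
  bit-true {true} _ = refl

  bit-false : ∀ {a} → ¬ T a → bit a ≡ 0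
  bit-false {false} _ = refl
  bit-false {true}  f = ⊥-elim (f tt)

  bit-cong : ∀ {a b} → (T a → T b) → (T b → T a) → bit a ≡ bit b
  bit-cong {false} {false} _ _ = refl
  bit-cong {false} {true}  _ g = ⊥-elim (g tt)
  bit-cong {true}  {false} f _ = ⊥-elim (f tt)
  bit-cong {true}  {true}  _ _ = refl

  private
    bit-mono : ∀ {a b} → (T a → T b) → bit a ≤ bit b
    bit-mono {false}         _ = z≤n
    bit-mono {true}  {true}  _ = ≤-refl
    bit-mono {true}  {false} f = ⊥-elim (f tt)

    bit-partition : ∀ {a b c} → (T a → T b ⊎ T c) → (T b → T a) → (T c → T a) →
                    (T b → ¬ T c) → bit a ≡ bit b + bit c
    bit-partition {false} {false} {false} _ _   _   _   = refl
    bit-partition {false} {true}          _ b⇒a _   _   = ⊥-elim (b⇒a tt)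
    bit-partition {false} {false} {true}  _ _   c⇒a _   = ⊥-elim (c⇒a tt)
    bit-partition {true}  {true}  {true}  _ _   _   b∩c = ⊥-elim (b∩c tt tt)
    bit-partition {true}  {true}  {false} _ _   _   _   = refl
    bit-partition {true}  {false} {true}  _ _   _   _   = refl
    bit-partition {true}  {false} {false} a⇒b∪c _ _ _ with a⇒b∪c tt
    ... | inj₁ ()
    ... | inj₂ ()

  count-cong : (P Q : Fin n → Bool) → P ⊆ᵇ Q → Q ⊆ᵇ P → count P ≡ count Q
  count-cong {zero}  P Q _   _   = refl
  count-cong {suc n} P Q P⊆Q Q⊆P =
    cong₂ _+_ (bit-cong (P⊆Q zero) (Q⊆P zero)) (count-cong (P ∘ suc) (Q ∘ suc) (P⊆Q ∘ suc) (Q⊆P ∘ suc))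

  count-mono : (P Q : Fin n → Bool) → P ⊆ᵇ Q → count P ≤ count Q
  count-mono {zero}  P Q _   = z≤n
  count-mono {suc n} P Q P⊆Q = +-mono-≤ (bit-mono (P⊆Q zero)) (count-mono (P ∘ suc) (Q ∘ suc) (P⊆Q ∘ suc))

  count-partition : (P Q R : Fin n → Bool) →
    (∀ x → T (P x) → T (Q x) ⊎ T (R x)) → Q ⊆ᵇ P → R ⊆ᵇ P → (∀ x → T (Q x) → ¬ T (R x)) →
    count P ≡ count Q + count R
  count-partition {zero}  P Q R _ _ _ _ = refl
  count-partition {suc n} P Q R cover Q⊆P R⊆P disjoint = begin
    bit (P zero) + count (P ∘ suc)
      ≡⟨ cong₂ _+_ (bit-partition (cover zero) (Q⊆P zero) (R⊆P zero) (disjoint zero))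
                   (count-partition (P ∘ suc) (Q ∘ suc) (R ∘ suc) (cover ∘ suc) (Q⊆P ∘ suc) (R⊆P ∘ suc) (disjoint ∘ suc)) ⟩
    (bit (Q zero) + bit (R zero)) + (count (Q ∘ suc) + count (R ∘ suc))
      ≡⟨ interchange (bit (Q zero)) _ _ _ ⟩
    count Q + count R ∎
    where open ≡-Reasoning

  count-∩ᵇ-─ᵇ : (P Q : Fin n → Bool) → count P ≡ count (P ∩ᵇ Q) + count (P ─ᵇ Q)
  count-∩ᵇ-─ᵇ P Q = count-partition P (P ∩ᵇ Q) (P ─ᵇ Q) cover (λ _ → ∩ᵇ⁻ˡ) (λ _ → ─ᵇ⁻ˡ) (λ _ p q → ─ᵇ⁻ʳ q (∩ᵇ⁻ʳ p))
    where
    cover : ∀ x → T (P x) → T ((P ∩ᵇ Q) x) ⊎ T ((P ─ᵇ Q) x)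
    cover x p with T? (Q x)
    ... | yes q = inj₁ (∩ᵇ⁺ p q)
    ... | no ¬q = inj₂ (─ᵇ⁺ p ¬q)

  count-─ᵇ : (P Q : Fin n → Bool) → Q ⊆ᵇ P → count P ≡ count Q + count (P ─ᵇ Q)
  count-─ᵇ P Q Q⊆P = trans (count-∩ᵇ-─ᵇ P Q)
    (cong (_+ count (P ─ᵇ Q)) (count-cong (P ∩ᵇ Q) Q (λ _ → ∩ᵇ⁻ʳ) (λ x q → ∩ᵇ⁺ (Q⊆P x q) q)))

  count-none : (P : Fin n → Bool) → (∀ x → ¬ T (P x)) → count P ≡ 0
  count-none {zero}  P _    = refl
  count-none {suc n} P none = cong₂ _+_ (bit-false (none zero)) (count-none (P ∘ suc) (none ∘ suc))

  count-witness : (P : Fin n → Bool) → 1 ≤ count P → ∃ λ x → T (P x)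
  count-witness {suc n} P pos with P zero in eq
  ... | true  = zero , subst T (sym eq) tt
  ... | false with count-witness (P ∘ suc) pos
  ...   | x , p = suc x , p

  count-complement : (P : Fin n → Bool) → count P + count (∁ᵇ P) ≡ n
  count-complement {n} P = begin
    count P + count (∁ᵇ P)                 ≡⟨ cong (_+ count (∁ᵇ P)) (count-cong P (full ∩ᵇ P) (λ _ → ∩ᵇ⁺ tt) (λ _ → ∩ᵇ⁻ʳ)) ⟩
    count (full ∩ᵇ P) + count (full ─ᵇ P) ≡⟨ count-∩ᵇ-─ᵇ full P ⟨
    count full                             ≡⟨ count-full n ⟩
    n ∎
    where
    open ≡-Reasoning
    full : Fin n → Bool
    full _ = true
    count-full : ∀ m → count {m} (λ _ → true) ≡ m
    count-full zero    = refl
    count-full (suc m) = cong suc (count-full m)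

  count-∪ᵇ : (P Q : Fin n → Bool) → count (P ∪ᵇ Q) ≤ count P + count Q
  count-∪ᵇ P Q = begin
    count (P ∪ᵇ Q)           ≡⟨ count-partition (P ∪ᵇ Q) P (Q ─ᵇ P) cover (λ _ → ∪ᵇ⁺ˡ) (λ _ → ∪ᵇ⁺ʳ ∘ ─ᵇ⁻ˡ)
                                  (λ _ p q → ─ᵇ⁻ʳ q p) ⟩
    count P + count (Q ─ᵇ P) ≤⟨ +-monoʳ-≤ (count P) (count-mono (Q ─ᵇ P) Q (λ _ → ─ᵇ⁻ˡ)) ⟩
    count P + count Q        ∎
    where
    open ≤-Reasoning
    cover : ∀ x → T ((P ∪ᵇ Q) x) → T (P x) ⊎ T ((Q ─ᵇ P) x)
    cover x p∪q with T? (P x) | ∪ᵇ⁻ p∪q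
    ... | yes p | _      = inj₁ p
    ... | no ¬p | inj₁ p = ⊥-elim (¬p p)
    ... | no ¬p | inj₂ q = inj₂ (─ᵇ⁺ q ¬p)

  count-⁅⁆ᵇ : (a : Fin n) → count ⁅ a ⁆ᵇ ≡ 1
  count-⁅⁆ᵇ {suc n} zero = cong₂ _+_ (bit-true (⁅⁆ᵇ⁺ refl)) (count-none (⁅ zero ⁆ᵇ ∘ suc) λ x p → 0≢suc (⁅⁆ᵇ⁻ p))
    where
    0≢suc : ∀ {x : Fin n} → ¬ zero ≡ suc x
    0≢suc ()
  count-⁅⁆ᵇ (suc a) = begin
    bit (⁅ suc a ⁆ᵇ zero) + count (⁅ suc a ⁆ᵇ ∘ suc)
      ≡⟨ cong₂ _+_ (bit-false (λ p → suc≢0 (⁅⁆ᵇ⁻ p)))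
                   (count-cong (⁅ suc a ⁆ᵇ ∘ suc) ⁅ a ⁆ᵇ (λ x p → ⁅⁆ᵇ⁺ (suc-injective (⁅⁆ᵇ⁻ p)))
                               (λ x p → ⁅⁆ᵇ⁺ (cong suc (⁅⁆ᵇ⁻ p)))) ⟩
    count ⁅ a ⁆ᵇ
      ≡⟨ count-⁅⁆ᵇ a ⟩
    1 ∎
    where
    open ≡-Reasoning
    suc≢0 : ∀ {n} {x : Fin n} → ¬ suc x ≡ zero
    suc≢0 ()

  count-unique : (P : Fin n → Bool) {a : Fin n} → T (P a) → (∀ x → T (P x) → x ≡ a) → count P ≡ 1
  count-unique P {a} pa unique = trans
    (count-cong P ⁅ a ⁆ᵇ (λ x p → ⁅⁆ᵇ⁺ (sym (unique x p))) (λ x p → subst (T ∘ P) (⁅⁆ᵇ⁻ p) pa))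
    (count-⁅⁆ᵇ a)

  count-positive : (P : Fin n → Bool) → T (P x) → 1 ≤ count P
  count-positive {x = x} P p =
    subst (_≤ count P) (count-⁅⁆ᵇ x) (count-mono ⁅ x ⁆ᵇ P λ y e → subst (T ∘ P) (⁅⁆ᵇ⁻ e) p)

  two-witnesses : (P : Fin n → Bool) → 2 ≤ count P →
    Σ (Fin n) λ x → Σ (Fin n) λ y → ¬ x ≡ y × T (P x) × T (P y)
  two-witnesses {n} P two = another (count-witness P (≤-trans (s≤s z≤n) two))
    where
    another : (∃ λ x → T (P x)) → Σ (Fin n) λ x → Σ (Fin n) λ y → ¬ x ≡ y × T (P x) × T (P y)
    another (x , px) = x , y , (λ x≡y → ─ᵇ⁻ʳ py (⁅⁆ᵇ⁺ x≡y)) , px , ─ᵇ⁻ˡ py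
      where
      rest : 1 ≤ count (P ─ᵇ ⁅ x ⁆ᵇ)
      rest = +-cancelˡ-≤ 1 1 _ (subst (2 ≤_)
        (trans (count-─ᵇ P ⁅ x ⁆ᵇ (λ y e → subst (T ∘ P) (⁅⁆ᵇ⁻ e) px)) (cong (_+ count (P ─ᵇ ⁅ x ⁆ᵇ)) (count-⁅⁆ᵇ x))) two)
      y  = proj₁ (count-witness (P ─ᵇ ⁅ x ⁆ᵇ) rest)
      py = proj₂ (count-witness (P ─ᵇ ⁅ x ⁆ᵇ) rest)

  _◂_ : ∀ {A : Set} → A → (Fin n → A) → Fin (suc n) → A
  (a ◂ f) zero    = a
  (a ◂ f) (suc i) = f i

  choose : (P : Fin n → Bool) (t : ℕ) → t ≤ count P → Σ (Fin n → Bool) λ Q → Q ⊆ᵇ P × count Q ≡ t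
  choose {zero}  P zero    _ = P , (λ _ q → q) , refl
  choose {suc n} P t t≤P with P zero in eq
  choose {suc n} P t       t≤P | false with choose (P ∘ suc) t t≤P
  ... | Q , Q⊆P , size = false ◂ Q , (λ { (suc x) → Q⊆P x }) , size
  choose {suc n} P zero    _   | true = (λ _ → false) , (λ _ ()) , count-none {suc n} (λ _ → false) (λ _ ())
  choose {suc n} P (suc t) t≤P | true with choose (P ∘ suc) t (≤-pred t≤P)
  ... | Q , Q⊆P , size = true ◂ Q , (λ { zero _ → subst T (sym eq) tt ; (suc x) → Q⊆P x }) , cong suc size

  choose-preferring : (P R : Fin n → Bool) (t : ℕ) → t ≤ count P →
    Σ (Fin n → Bool) λ Q → Q ⊆ᵇ P × count Q ≡ t ×
      (count (P ∩ᵇ R) ≤ t → P ∩ᵇ R ⊆ᵇ Q) × (t ≤ count (P ∩ᵇ R) → Q ⊆ᵇ R)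
  choose-preferring P R t t≤P with count (P ∩ᵇ R) ≤? t
  ... | no PR≰t with choose (P ∩ᵇ R) t (<⇒≤ (≰⇒> PR≰t))
  ...   | Q , Q⊆PR , size =
    Q , (λ x → ∩ᵇ⁻ˡ ∘ Q⊆PR x) , size , (λ PR≤t → ⊥-elim (PR≰t PR≤t)) , (λ _ x → ∩ᵇ⁻ʳ ∘ Q⊆PR x)
  choose-preferring P R t t≤P | yes PR≤t = PR ∪ᵇ S , PR∪S⊆P , size , (λ _ _ → ∪ᵇ⁺ˡ) , PR∪S⊆R
    where
    PR = P ∩ᵇ R
    rest : t ∸ count PR ≤ count (P ─ᵇ R)
    rest = ≤-trans (∸-monoˡ-≤ (count PR) t≤P)
                   (≤-reflexive (trans (cong (_∸ count PR) (count-∩ᵇ-─ᵇ P R)) (m+n∸m≡n (count PR) _)))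
    S   = proj₁ (choose (P ─ᵇ R) (t ∸ count PR) rest)
    S⊆  = proj₁ (proj₂ (choose (P ─ᵇ R) (t ∸ count PR) rest))
    ∣S∣ = proj₂ (proj₂ (choose (P ─ᵇ R) (t ∸ count PR) rest))
    PR∪S⊆P : PR ∪ᵇ S ⊆ᵇ P
    PR∪S⊆P x q with ∪ᵇ⁻ q
    ... | inj₁ pr = ∩ᵇ⁻ˡ pr
    ... | inj₂ s  = ─ᵇ⁻ˡ (S⊆ x s)
    size : count (PR ∪ᵇ S) ≡ t
    size = begin
      count (PR ∪ᵇ S)
        ≡⟨ count-partition (PR ∪ᵇ S) PR S (λ _ → ∪ᵇ⁻) (λ _ → ∪ᵇ⁺ˡ) (λ _ → ∪ᵇ⁺ʳ)
                           (λ x pr s → ─ᵇ⁻ʳ (S⊆ x s) (∩ᵇ⁻ʳ pr)) ⟩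
      count PR + count S           ≡⟨ cong (count PR +_) ∣S∣ ⟩
      count PR + (t ∸ count PR)    ≡⟨ m+[n∸m]≡n PR≤t ⟩
      t ∎
      where open ≡-Reasoning
    PR∪S⊆R : t ≤ count PR → PR ∪ᵇ S ⊆ᵇ R
    PR∪S⊆R t≤PR x q with ∪ᵇ⁻ q
    ... | inj₁ pr = ∩ᵇ⁻ʳ pr
    ... | inj₂ s  = ⊥-elim (1+n≰n (≤-trans (count-positive S s)
                      (≤-reflexive (trans ∣S∣ (m≤n⇒m∸n≡0 t≤PR)))))


  opaque
    image : ∀ {k} → (Fin k → Fin n) → Fin n → Bool
    image h x = isYes (any? λ j → h j ≟ x)

    image⁺ : ∀ {k} {h : Fin k → Fin n} j → T (image h (h j))
    image⁺ {h = h} j = fromWitness {a? = any? λ i → h i ≟ h j} (j , refl)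

    image⁻ : ∀ {k} {h : Fin k → Fin n} {x} → T (image h x) → ∃ λ j → h j ≡ x
    image⁻ {h = h} {x} = toWitness {a? = any? λ i → h i ≟ x}

  count-image : ∀ {k} (h : Fin k → Fin n) → count (image h) ≤ k
  count-image {k = zero}  h = ≤-reflexive (count-none (image h) λ x p → absurd (image⁻ p))
    where
    absurd : ∀ {x} → ¬ ∃ λ (j : Fin 0) → h j ≡ x
    absurd (() , _)
  count-image {k = suc k} h = begin
    count (image h)                           ≤⟨ count-mono (image h) (⁅ h zero ⁆ᵇ ∪ᵇ image (h ∘ suc)) split ⟩
    count (⁅ h zero ⁆ᵇ ∪ᵇ image (h ∘ suc))     ≤⟨ count-∪ᵇ ⁅ h zero ⁆ᵇ (image (h ∘ suc)) ⟩
    count ⁅ h zero ⁆ᵇ + count (image (h ∘ suc)) ≤⟨ +-mono-≤ (≤-reflexive (count-⁅⁆ᵇ (h zero))) (count-image (h ∘ suc)) ⟩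
    suc k ∎
    where
    open ≤-Reasoning
    split : image h ⊆ᵇ ⁅ h zero ⁆ᵇ ∪ᵇ image (h ∘ suc)
    split x p with image⁻ p
    ... | zero  , refl = ∪ᵇ⁺ˡ (⁅⁆ᵇ⁺ refl)
    ... | suc j , refl = ∪ᵇ⁺ʳ (image⁺ j)

  sumF-cong : (f g : Fin n → ℕ) → (∀ i → f i ≡ g i) → sumF f ≡ sumF g
  sumF-cong {zero}  f g _   = refl
  sumF-cong {suc n} f g f≗g = cong₂ _+_ (f≗g zero) (sumF-cong (f ∘ suc) (g ∘ suc) (f≗g ∘ suc))

  sumF-mono : (f g : Fin n → ℕ) → (∀ i → f i ≤ g i) → sumF f ≤ sumF g
  sumF-mono {zero}  f g _   = z≤n
  sumF-mono {suc n} f g f≤g = +-mono-≤ (f≤g zero) (sumF-mono (f ∘ suc) (g ∘ suc) (f≤g ∘ suc))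

  sumF-+ : (f g : Fin n → ℕ) → sumF (λ i → f i + g i) ≡ sumF f + sumF g
  sumF-+ {zero}  f g = refl
  sumF-+ {suc n} f g = trans (cong (f zero + g zero +_) (sumF-+ (f ∘ suc) (g ∘ suc))) (interchange (f zero) _ _ _)

  sumF-bit : (P : Fin n → Bool) → sumF (bit ∘ P) ≡ count P
  sumF-bit {zero}  P = refl
  sumF-bit {suc n} P = cong (bit (P zero) +_) (sumF-bit (P ∘ suc))

  sumF-bit-* : (P : Fin n → Bool) (c : ℕ) → sumF (λ i → bit (P i) * c) ≡ count P * c
  sumF-bit-* {zero}  P c = refl
  sumF-bit-* {suc n} P c =
    trans (cong (bit (P zero) * c +_) (sumF-bit-* (P ∘ suc) c)) (sym (*-distribʳ-+ c (bit (P zero)) _))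

  sumF≡0 : (f : Fin n → ℕ) → sumF f ≡ 0 → ∀ i → f i ≡ 0
  sumF≡0 f Σf≡0 zero    = m+n≡0⇒m≡0 (f zero) Σf≡0
  sumF≡0 f Σf≡0 (suc i) = sumF≡0 (f ∘ suc) (m+n≡0⇒n≡0 (f zero) Σf≡0) i

  sumF-positive : (f : Fin n → ℕ) → 1 ≤ sumF f → ∃ λ i → 1 ≤ f i
  sumF-positive {suc n} f pos with f zero in eq
  ... | suc _ = zero , subst (1 ≤_) (sym eq) (s≤s z≤n)
  ... | zero with sumF-positive (f ∘ suc) pos
  ...   | i , fi = suc i , fi

  erase : Fin n → (Fin n → ℕ) → Fin n → ℕ
  erase a f i with a ≟ i
  ... | yes _ = 0
  ... | no  _ = f i

  erase-≢ : (a i : Fin n) (f : Fin n → ℕ) → ¬ a ≡ i → erase a f i ≡ f i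
  erase-≢ a i f a≢i with a ≟ i
  ... | yes a≡i = ⊥-elim (a≢i a≡i)
  ... | no  _   = refl

  erase-self : ∀ (a : Fin n) (f : Fin n → ℕ) → erase a f a ≡ 0
  erase-self a f with a ≟ a
  ... | yes _   = refl
  ... | no  a≢a = ⊥-elim (a≢a refl)

  sumF-erase : (a : Fin n) (f : Fin n → ℕ) → sumF f ≡ f a + sumF (erase a f)
  sumF-erase zero    f = cong (f zero +_) (sumF-cong (f ∘ suc) (erase zero f ∘ suc) λ i → sym (erase-≢ zero (suc i) f λ ()))
  sumF-erase (suc a) f = begin
    f zero + sumF (f ∘ suc)
      ≡⟨ cong (f zero +_) (sumF-erase a (f ∘ suc)) ⟩
    f zero + (f (suc a) + sumF (erase a (f ∘ suc)))
      ≡⟨ x∙yz≈y∙xz (f zero) (f (suc a)) _ ⟩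
    f (suc a) + (f zero + sumF (erase a (f ∘ suc)))
      ≡⟨ cong (f (suc a) +_) (cong₂ _+_ (sym (erase-≢ (suc a) zero f λ ())) (sumF-cong _ _ erase-suc)) ⟩
    f (suc a) + sumF (erase (suc a) f) ∎
    where
    open ≡-Reasoning
    erase-suc : ∀ i → erase a (f ∘ suc) i ≡ erase (suc a) f (suc i)
    erase-suc i = case-on (a ≟ i)
      where
      case-on : Dec (a ≡ i) → erase a (f ∘ suc) i ≡ erase (suc a) f (suc i)
      case-on (yes refl) = trans (erase-self a (f ∘ suc)) (sym (erase-self (suc a) f))
      case-on (no  a≢i)  = trans (erase-≢ a i (f ∘ suc) a≢i) (sym (erase-≢ (suc a) (suc i) f (a≢i ∘ suc-injective)))

  -- Greedily, one element at a time; elements outside X are sent to the dummy block u₀.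
  assign : ∀ {k} (c : Fin k → ℕ) (X : Fin n → Bool) → Fin k → sumF c ≡ count X →
    Σ (Fin n → Fin k) λ own → ∀ u → count (X ∩ᵇ (⁅ u ⁆ᵇ ∘ own)) ≡ c u
  assign {zero}  c X u₀ Σc≡0 = (λ ()) , λ u → sym (sumF≡0 c Σc≡0 u)
  assign {suc n} {k} c X u₀ Σc≡∣X∣ with X zero in eq
  ... | false = own , fibre
    where
    rest = assign c (X ∘ suc) u₀ Σc≡∣X∣
    own = u₀ ◂ proj₁ rest
    fibre : ∀ u → count (X ∩ᵇ (⁅ u ⁆ᵇ ∘ own)) ≡ c u
    fibre u = begin
      bit ((X ∩ᵇ (⁅ u ⁆ᵇ ∘ own)) zero) + count ((X ∩ᵇ (⁅ u ⁆ᵇ ∘ own)) ∘ suc)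
        ≡⟨ cong₂ _+_ (bit-false (λ p → subst T eq (∩ᵇ⁻ˡ p))) (cong count (∘-∩ᵇ X (⁅ u ⁆ᵇ ∘ own) suc)) ⟩
      count ((X ∘ suc) ∩ᵇ (⁅ u ⁆ᵇ ∘ proj₁ rest))
        ≡⟨ proj₂ rest u ⟩
      c u ∎
      where open ≡-Reasoning
  ... | true = own , fibre
    where
    u₁  = proj₁ (sumF-positive c (subst (1 ≤_) (sym Σc≡∣X∣) (s≤s z≤n)))
    cu₁ = proj₂ (sumF-positive c (subst (1 ≤_) (sym Σc≡∣X∣) (s≤s z≤n)))
    hit : Fin k → ℕ
    hit u = bit (⁅ u ⁆ᵇ u₁)
    hit≤c : ∀ u → hit u ≤ c u
    hit≤c u with T? (⁅ u ⁆ᵇ u₁)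
    ... | yes p = subst (λ v → hit u ≤ c v) (sym (⁅⁆ᵇ⁻ p)) (≤-trans (≤-reflexive (bit-true p)) cu₁)
    ... | no ¬p = subst (_≤ c u) (sym (bit-false ¬p)) z≤n
    c′ : Fin k → ℕ
    c′ u = c u ∸ hit u
    Σc′ : sumF c′ ≡ count (X ∘ suc)
    Σc′ = +-cancelʳ-≡ 1 (sumF c′) (count (X ∘ suc)) (begin
      sumF c′ + 1              ≡⟨ cong (sumF c′ +_) (sym (trans (sumF-bit (λ u → ⁅ u ⁆ᵇ u₁))
                                    (count-unique (λ u → ⁅ u ⁆ᵇ u₁) (⁅⁆ᵇ⁺ refl) (λ _ → ⁅⁆ᵇ⁻)))) ⟩
      sumF c′ + sumF hit       ≡⟨ sumF-+ c′ hit ⟨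
      sumF (λ u → c′ u + hit u) ≡⟨ sumF-cong _ c (λ u → m∸n+n≡m (hit≤c u)) ⟩
      sumF c                   ≡⟨ Σc≡∣X∣ ⟩
      1 + count (X ∘ suc)      ≡⟨ +-comm 1 _ ⟩
      count (X ∘ suc) + 1 ∎)
      where open ≡-Reasoning
    rest = assign c′ (X ∘ suc) u₀ Σc′
    own = u₁ ◂ proj₁ rest
    fibre : ∀ u → count (X ∩ᵇ (⁅ u ⁆ᵇ ∘ own)) ≡ c u
    fibre u = begin
      bit ((X ∩ᵇ (⁅ u ⁆ᵇ ∘ own)) zero) + count ((X ∩ᵇ (⁅ u ⁆ᵇ ∘ own)) ∘ suc)
        ≡⟨ cong₂ _+_ (bit-cong ∩ᵇ⁻ʳ (∩ᵇ⁺ (subst T (sym eq) tt))) (cong count (∘-∩ᵇ X (⁅ u ⁆ᵇ ∘ own) suc)) ⟩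
      hit u + count ((X ∘ suc) ∩ᵇ (⁅ u ⁆ᵇ ∘ proj₁ rest))
        ≡⟨ cong (hit u +_) (proj₂ rest u) ⟩
      hit u + (c u ∸ hit u)
        ≡⟨ m+[n∸m]≡n (hit≤c u) ⟩
      c u ∎
      where open ≡-Reasoning

open Counting

Least Greatest : ∀ {n} → (Fin n → Bool) → Set
Least    {n} P = Σ (Fin n) λ x → T (P x) × (∀ z → T (P z) → toℕ x ≤ toℕ z)
Greatest {n} P = Σ (Fin n) λ x → T (P x) × (∀ z → T (P z) → toℕ z ≤ toℕ x)

least? : ∀ {n} (P : Fin n → Bool) → (∀ x → ¬ T (P x)) ⊎ Least P
least? {zero}  P = inj₁ λ ()
least? {suc n} P with P zero in eq
... | true  = inj₂ (zero , subst T (sym eq) tt , λ _ _ → z≤n)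
... | false with least? (P ∘ suc)
...   | inj₁ none = inj₁ λ { zero p → subst T eq p ; (suc z) → none z }
...   | inj₂ (x , px , min) = inj₂ (suc x , px , λ { zero p → ⊥-elim (subst T eq p) ; (suc z) p → s≤s (min z p) })

greatest? : ∀ {n} (P : Fin n → Bool) → (∀ x → ¬ T (P x)) ⊎ Greatest P
greatest? {zero}  P = inj₁ λ ()
greatest? {suc n} P with greatest? (P ∘ suc)
... | inj₂ (x , px , max) = inj₂ (suc x , px , λ { zero _ → z≤n ; (suc z) p → s≤s (max z p) })
... | inj₁ none with P zero in eq
...   | true  = inj₂ (zero , subst T (sym eq) tt , λ { zero _ → z≤n ; (suc z) p → ⊥-elim (none z p) })
...   | false = inj₁ λ { zero p → subst T eq p ; (suc z) → none z }

-- The vertices of U in increasing order, from a to r, form the spine of a caterpillar.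
module Spine {n} (U : Fin n → Bool) (two-inner : 2 ≤ count U) where

  private
    some-inner : ∃ λ x → T (U x)
    some-inner = count-witness U (≤-trans (s≤s z≤n) two-inner)

    toℕ-≤-antisym : ∀ {x y : Fin n} → toℕ x ≤ toℕ y → toℕ y ≤ toℕ x → x ≡ y
    toℕ-≤-antisym x≤y y≤x = toℕ-injective (≤-antisym x≤y y≤x)

  least-inner : Least U
  least-inner with least? U
  ... | inj₁ none = ⊥-elim (none _ (proj₂ some-inner))
  ... | inj₂ l    = l

  greatest-inner : Greatest U
  greatest-inner with greatest? U
  ... | inj₁ none = ⊥-elim (none _ (proj₂ some-inner))
  ... | inj₂ g    = g

  a r : Fin n
  a = proj₁ least-inner
  r = proj₁ greatest-inner

  a-inner : T (U a)
  a-inner = proj₁ (proj₂ least-inner)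

  r-inner : T (U r)
  r-inner = proj₁ (proj₂ greatest-inner)

  a-least : ∀ z → T (U z) → toℕ a ≤ toℕ z
  a-least = proj₂ (proj₂ least-inner)

  r-greatest : ∀ z → T (U z) → toℕ z ≤ toℕ r
  r-greatest = proj₂ (proj₂ greatest-inner)

  a≢r : ¬ a ≡ r
  a≢r a≡r with two-witnesses U two-inner
  ... | x , y , x≢y , ux , uy = x≢y (trans (is-a x ux) (sym (is-a y uy)))
    where
    is-a : ∀ z → T (U z) → z ≡ a
    is-a z uz = toℕ-≤-antisym (subst (λ v → toℕ z ≤ toℕ v) (sym a≡r) (r-greatest z uz)) (a-least z uz)

  below-r : ∀ w → T (U w) → ¬ w ≡ r → toℕ w < toℕ r
  below-r w uw w≢r = ≤∧≢⇒< (r-greatest w uw) (w≢r ∘ toℕ-injective)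

  Above : Fin n → Fin n → Bool
  Above w = (λ z → toℕ w <ᵇ toℕ z) ∩ᵇ U

  NextSpec : Fin n → Fin n → Set
  NextSpec w v = T (U v) × toℕ w < toℕ v × (∀ z → T (U z) → toℕ w < toℕ z → toℕ v ≤ toℕ z)

  private
    nextOf : ∀ {w} → (∀ x → ¬ T (Above w x)) ⊎ Least (Above w) → Fin n
    nextOf (inj₁ _)       = r
    nextOf (inj₂ (v , _)) = v

  -- On r itself next is a junk value.
  next : Fin n → Fin n
  next w = nextOf (least? (Above w))

  next-spec : ∀ w → T (U w) → ¬ w ≡ r → NextSpec w (next w)
  next-spec w uw w≢r = spec (least? (Above w))
    where
    spec : (l : (∀ x → ¬ T (Above w x)) ⊎ Least (Above w)) → NextSpec w (nextOf l)
    spec (inj₁ none) = ⊥-elim (none r (∩ᵇ⁺ (<⇒<ᵇ (below-r w uw w≢r)) r-inner))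
    spec (inj₂ (v , above , min)) =
      ∩ᵇ⁻ʳ above , <ᵇ⇒< _ _ (∩ᵇ⁻ˡ above) , λ z uz w<z → min z (∩ᵇ⁺ (<⇒<ᵇ w<z) uz)

  next-inner : ∀ w → T (U w) → ¬ w ≡ r → T (U (next w))
  next-inner w uw w≢r = proj₁ (next-spec w uw w≢r)

  next-> : ∀ w → T (U w) → ¬ w ≡ r → toℕ w < toℕ (next w)
  next-> w uw w≢r = proj₁ (proj₂ (next-spec w uw w≢r))

  nothing-between : ∀ w → T (U w) → ¬ w ≡ r → ∀ z → T (U z) → toℕ w < toℕ z → toℕ (next w) ≤ toℕ z
  nothing-between w uw w≢r = proj₂ (proj₂ (next-spec w uw w≢r))

  next≢a : ∀ w → T (U w) → ¬ w ≡ r → ¬ next w ≡ a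
  next≢a w uw w≢r next≡a =
    <⇒≱ (subst (λ v → toℕ w < toℕ v) next≡a (next-> w uw w≢r)) (a-least w uw)

  next-injective : ∀ v w → T (U v) → ¬ v ≡ r → T (U w) → ¬ w ≡ r → next v ≡ next w → v ≡ w
  next-injective v w uv v≢r uw w≢r eq with <-cmp (toℕ v) (toℕ w)
  ... | tri≈ _ v≡w _ = toℕ-injective v≡w
  ... | tri< v<w _ _ = ⊥-elim (<⇒≱ (next-> w uw w≢r)
                          (subst (λ x → toℕ x ≤ toℕ w) eq (nothing-between v uv v≢r w uw v<w)))
  ... | tri> _ _ w<v = ⊥-elim (<⇒≱ (next-> v uv v≢r)
                          (subst (λ x → toℕ x ≤ toℕ v) (sym eq) (nothing-between w uw w≢r v uv w<v)))

  previous : ∀ u → T (U u) → ¬ u ≡ a → Σ (Fin n) λ p → T (U p) × ¬ p ≡ r × next p ≡ u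
  previous u uu u≢a with greatest? (U ∩ᵇ (λ z → toℕ z <ᵇ toℕ u))
  ... | inj₁ none = ⊥-elim (none a (∩ᵇ⁺ a-inner (<⇒<ᵇ a<u)))
    where
    a<u : toℕ a < toℕ u
    a<u = ≤∧≢⇒< (a-least u uu) (λ e → u≢a (sym (toℕ-injective e)))
  ... | inj₂ (p , below , max) = p , up , p≢r , toℕ-≤-antisym next≤u u≤next
    where
    up  = ∩ᵇ⁻ˡ below
    p<u = <ᵇ⇒< _ _ (∩ᵇ⁻ʳ below)
    p≢r : ¬ p ≡ r
    p≢r p≡r = <⇒≱ p<u (subst (λ v → toℕ u ≤ toℕ v) (sym p≡r) (r-greatest u uu))
    next≤u : toℕ (next p) ≤ toℕ u
    next≤u = nothing-between p up p≢r u uu p<u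
    u≤next : toℕ u ≤ toℕ (next p)
    u≤next = ≮⇒≥ λ next<u → <⇒≱ (next-> p up p≢r)
               (max (next p) (∩ᵇ⁺ (next-inner p up p≢r) (<⇒<ᵇ next<u)))

  private
    inner-between : ∀ w z → T (U w) → ¬ w ≡ r → T (U z) → toℕ w < toℕ z → ¬ z ≡ next w → toℕ (next w) < toℕ z
    inner-between w z uw w≢r uz w<z z≢next =
      ≤∧≢⇒< (nothing-between w uw w≢r z uz w<z) (λ e → z≢next (sym (toℕ-injective e)))

  short-spine₂ : next a ≡ r → count U ≤ 2
  short-spine₂ next-a≡r = begin
    count U                    ≤⟨ count-mono U (⁅ a ⁆ᵇ ∪ᵇ ⁅ r ⁆ᵇ) cover ⟩
    count (⁅ a ⁆ᵇ ∪ᵇ ⁅ r ⁆ᵇ)     ≤⟨ count-∪ᵇ ⁅ a ⁆ᵇ ⁅ r ⁆ᵇ ⟩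
    count ⁅ a ⁆ᵇ + count ⁅ r ⁆ᵇ ≡⟨ cong₂ _+_ (count-⁅⁆ᵇ a) (count-⁅⁆ᵇ r) ⟩
    2 ∎
    where
    open ≤-Reasoning
    cover : U ⊆ᵇ ⁅ a ⁆ᵇ ∪ᵇ ⁅ r ⁆ᵇ
    cover z uz with a ≟ z | r ≟ z
    ... | yes a≡z | _ = ∪ᵇ⁺ˡ (⁅⁆ᵇ⁺ a≡z)
    ... | no _ | yes r≡z = ∪ᵇ⁺ʳ (⁅⁆ᵇ⁺ r≡z)
    ... | no a≢z | no r≢z = ⊥-elim (<⇒≱
          (inner-between a z a-inner a≢r uz (≤∧≢⇒< (a-least z uz) (a≢z ∘ toℕ-injective))
                         (λ z≡ → r≢z (sym (trans z≡ next-a≡r))))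
          (subst (λ v → toℕ z ≤ toℕ v) (sym next-a≡r) (r-greatest z uz)))

  short-spine₃ : ¬ next a ≡ r → next (next a) ≡ r → count U ≤ 3
  short-spine₃ next-a≢r next²-a≡r = begin
    count U                                       ≤⟨ count-mono U (⁅ a ⁆ᵇ ∪ᵇ (⁅ c ⁆ᵇ ∪ᵇ ⁅ r ⁆ᵇ)) cover ⟩
    count (⁅ a ⁆ᵇ ∪ᵇ (⁅ c ⁆ᵇ ∪ᵇ ⁅ r ⁆ᵇ))            ≤⟨ count-∪ᵇ ⁅ a ⁆ᵇ _ ⟩
    count ⁅ a ⁆ᵇ + count (⁅ c ⁆ᵇ ∪ᵇ ⁅ r ⁆ᵇ)        ≤⟨ +-monoʳ-≤ (count ⁅ a ⁆ᵇ) (count-∪ᵇ ⁅ c ⁆ᵇ ⁅ r ⁆ᵇ) ⟩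
    count ⁅ a ⁆ᵇ + (count ⁅ c ⁆ᵇ + count ⁅ r ⁆ᵇ) ≡⟨ cong₂ _+_ (count-⁅⁆ᵇ a) (cong₂ _+_ (count-⁅⁆ᵇ c) (count-⁅⁆ᵇ r)) ⟩
    3 ∎
    where
    open ≤-Reasoning
    c = next a
    c-inner = next-inner a a-inner a≢r
    cover : U ⊆ᵇ ⁅ a ⁆ᵇ ∪ᵇ (⁅ c ⁆ᵇ ∪ᵇ ⁅ r ⁆ᵇ)
    cover z uz with a ≟ z | c ≟ z | r ≟ z
    ... | yes a≡z | _ | _ = ∪ᵇ⁺ˡ (⁅⁆ᵇ⁺ a≡z)
    ... | no _ | yes c≡z | _ = ∪ᵇ⁺ʳ (∪ᵇ⁺ˡ (⁅⁆ᵇ⁺ c≡z))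
    ... | no _ | no _ | yes r≡z = ∪ᵇ⁺ʳ (∪ᵇ⁺ʳ (⁅⁆ᵇ⁺ r≡z))
    ... | no a≢z | no c≢z | no r≢z = ⊥-elim (<⇒≱
          (inner-between c z c-inner next-a≢r uz
            (inner-between a z a-inner a≢r uz (≤∧≢⇒< (a-least z uz) (a≢z ∘ toℕ-injective)) (c≢z ∘ sym))
            (λ z≡ → r≢z (sym (trans z≡ next²-a≡r))))
          (subst (λ v → toℕ z ≤ toℕ v) (sym next²-a≡r) (r-greatest z uz)))

  -- The degree of v in the caterpillar before any leaf is attached to the spine: one edge towards r
  -- unless v ≡ r, one from the spine predecessor if v is inner and v ≢ a.
  skeleton : Fin n → ℕ
  skeleton v = bit (∁ᵇ ⁅ r ⁆ᵇ v) + bit ((U ─ᵇ ⁅ a ⁆ᵇ) v)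

  interior : Fin n → Bool
  interior = (U ─ᵇ ⁅ a ⁆ᵇ) ─ᵇ ⁅ r ⁆ᵇ

  count-interior : 2 + count interior ≡ count U
  count-interior = sym (begin
    count U                                  ≡⟨ count-─ᵇ U ⁅ a ⁆ᵇ (λ x a≡x → subst (T ∘ U) (⁅⁆ᵇ⁻ a≡x) a-inner) ⟩
    count ⁅ a ⁆ᵇ + count (U ─ᵇ ⁅ a ⁆ᵇ)        ≡⟨ cong₂ _+_ (count-⁅⁆ᵇ a)
                                                  (count-─ᵇ (U ─ᵇ ⁅ a ⁆ᵇ) ⁅ r ⁆ᵇ r∈U-a) ⟩
    1 + (count ⁅ r ⁆ᵇ + count interior)      ≡⟨ cong (λ c → 1 + (c + count interior)) (count-⁅⁆ᵇ r) ⟩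
    2 + count interior ∎)
    where
    open ≡-Reasoning
    r∈U-a : ⁅ r ⁆ᵇ ⊆ᵇ U ─ᵇ ⁅ a ⁆ᵇ
    r∈U-a x r≡x = subst (λ z → T ((U ─ᵇ ⁅ a ⁆ᵇ) z)) (⁅⁆ᵇ⁻ r≡x) (─ᵇ⁺ r-inner (a≢r ∘ ⁅⁆ᵇ⁻))

  skeleton-a : skeleton a ≡ 1
  skeleton-a = cong₂ _+_ (bit-true (∁ᵇ⁺ (a≢r ∘ sym ∘ ⁅⁆ᵇ⁻))) (bit-false λ p → ─ᵇ⁻ʳ p (⁅⁆ᵇ⁺ refl))

  skeleton-r : skeleton r ≡ 1
  skeleton-r = cong₂ _+_ (bit-false λ p → ∁ᵇ⁻ p (⁅⁆ᵇ⁺ refl)) (bit-true (─ᵇ⁺ r-inner (a≢r ∘ ⁅⁆ᵇ⁻)))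

  skeleton-interior : ∀ v → T (interior v) → skeleton v ≡ 2
  skeleton-interior v p = cong₂ _+_ (bit-true (∁ᵇ⁺ (─ᵇ⁻ʳ p))) (bit-true (─ᵇ⁻ˡ p))

  skeleton-leaf : ∀ v → ¬ T (U v) → skeleton v ≡ 1
  skeleton-leaf v ¬uv = cong₂ _+_ (bit-true (∁ᵇ⁺ λ r≡v → ¬uv (subst (T ∘ U) (⁅⁆ᵇ⁻ r≡v) r-inner)))
                                  (bit-false (¬uv ∘ ─ᵇ⁻ˡ))

  skeleton≤2 : ∀ v → skeleton v ≤ 2
  skeleton≤2 v = +-mono-≤ (bit≤1 (∁ᵇ ⁅ r ⁆ᵇ v)) (bit≤1 ((U ─ᵇ ⁅ a ⁆ᵇ) v))
    where
    bit≤1 : ∀ b → bit b ≤ 1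
    bit≤1 true  = ≤-refl
    bit≤1 false = z≤n

module _ {n} (G : SimpleGraph n) where

  Adj-sym : ∀ {u v} → Adj G u v → Adj G v u
  Adj-sym {u} {v} = subst T (SimpleGraph.sym G u v)

  -- A star has diameter at most 2.
  ¬star : ∀ S x y → x ∈ S → y ∈ S → ¬ x ≡ y → ¬ Adj G x y → (∀ c → Adj G c x → Adj G c y → ⊥) →
          ¬ IsStarOn G S
  ¬star S x y x∈S y∈S x≢y x≁y no-common (c , _ , centre) with x ≟ c | y ≟ c
  ... | yes refl | _        = x≁y (centre y y∈S (x≢y ∘ sym))
  ... | no _     | yes refl = x≁y (Adj-sym (centre x x∈S x≢y))
  ... | no x≢c   | no y≢c   = no-common c (centre x x∈S x≢c) (centre y y∈S y≢c)

-- The graph joining every vertex w ≢ r to parent w; the rank makes it acyclic.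
module ParentTree {n} (r : Fin n) (parent : Fin n → Fin n) (rank : Fin n → ℕ)
                  (rank-parent : ∀ w → ¬ w ≡ r → rank (parent w) < rank w) where

  ChildOf : Fin n → Fin n → Set
  ChildOf w v = ¬ w ≡ r × parent w ≡ v

  opaque
    isChild : Fin n → Fin n → Bool
    isChild w v = isYes (¬? (w ≟ r) ×-dec (parent w ≟ v))

    isChild⁺ : ∀ w v → ChildOf w v → T (isChild w v)
    isChild⁺ w v = fromWitness

    isChild⁻ : ∀ w v → T (isChild w v) → ChildOf w v
    isChild⁻ w v = toWitness

  child-rank : ∀ {w v} → ChildOf w v → rank v < rank w
  child-rank {w} (w≢r , refl) = rank-parent w w≢r

  parent-unique : ∀ {w u v} → ChildOf w u → ChildOf w v → u ≡ v
  parent-unique (_ , refl) (_ , refl) = refl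

  private
    isChild-irrefl : ∀ v → isChild v v ≡ false
    isChild-irrefl v with isChild v v in eq
    ... | false = refl
    ... | true  = ⊥-elim (<-irrefl refl (child-rank (isChild⁻ v v (subst T (sym eq) tt))))

    isChild-∨-irrefl : ∀ v → isChild v v ∨ isChild v v ≡ false
    isChild-∨-irrefl v rewrite isChild-irrefl v = refl

  graph : SimpleGraph n
  graph = record
    { adj    = λ u v → isChild u v ∨ isChild v u
    ; sym    = λ u v → ∨-comm (isChild u v) (isChild v u)
    ; irrefl = isChild-∨-irrefl
    }

  Adj⁻ : ∀ u v → Adj graph u v → ChildOf u v ⊎ ChildOf v u
  Adj⁻ u v adj with isChild u v in eq₁ | isChild v u in eq₂
  ... | true  | _    = inj₁ (isChild⁻ u v (subst T (sym eq₁) tt))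
  ... | false | true = inj₂ (isChild⁻ v u (subst T (sym eq₂) tt))

  Adj⁺ : ∀ u v → ChildOf u v ⊎ ChildOf v u → Adj graph u v
  Adj⁺ u v (inj₁ c) with isChild u v | isChild⁺ u v c
  ... | true | _ = tt
  Adj⁺ u v (inj₂ c) = Adj-sym graph {v} {u} (Adj⁺ v u (inj₁ c))

  degree-graph : ∀ v → degree graph v ≡ bit (∁ᵇ ⁅ r ⁆ᵇ v) + count (λ w → isChild w v)
  degree-graph v = begin
    degree graph v
      ≡⟨ ∣tabulate∣≡count (adj graph v) ⟩
    count (adj graph v)
      ≡⟨ count-partition (adj graph v) (isChild v) (λ w → isChild w v) (λ w → to T-∨)
           (λ w → from T-∨ ∘ inj₁) (λ w → from T-∨ ∘ inj₂)
           (λ w c c′ → <-asym (child-rank (isChild⁻ v w c)) (child-rank (isChild⁻ w v c′))) ⟩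
    count (isChild v) + count (λ w → isChild w v)
      ≡⟨ cong (_+ count (λ w → isChild w v)) to-parent ⟩
    bit (∁ᵇ ⁅ r ⁆ᵇ v) + count (λ w → isChild w v) ∎
    where
    open ≡-Reasoning
    open Equivalence using (to; from)
    to-parent : count (isChild v) ≡ bit (∁ᵇ ⁅ r ⁆ᵇ v)
    to-parent = by-cases (v ≟ r)
      where
      by-cases : Dec (v ≡ r) → count (isChild v) ≡ bit (∁ᵇ ⁅ r ⁆ᵇ v)
      by-cases (yes v≡r) = trans (count-none (isChild v) λ w c → proj₁ (isChild⁻ v w c) v≡r)
        (sym (bit-false (λ p → ∁ᵇ⁻ p (⁅⁆ᵇ⁺ (sym v≡r)))))
      by-cases (no  v≢r) = trans (count-unique (isChild v) (isChild⁺ v (parent v) (v≢r , refl))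
                                   (λ w c → sym (proj₂ (isChild⁻ v w c))))
        (sym (bit-true (∁ᵇ⁺ (v≢r ∘ sym ∘ ⁅⁆ᵇ⁻))))

  module _ (S : Subset n) where

    private
      walk-cons : ∀ {u w v} → u ∈ S → Adj graph u w → WalkIn graph S w v → WalkIn graph S u v
      walk-cons u∈S u~w (xs , all , chain , end) = (_ ∷ xs) , (u∈S ∷ all) , (u~w , chain) , end

      walk-snoc : ∀ {u w v} → WalkIn graph S u w → Adj graph w v → v ∈ S → WalkIn graph S u v
      walk-snoc ([] , all , _ , refl) w~v v∈S = (_ ∷ []) , (All.head all ∷ v∈S ∷ []) , (w~v , tt) , refl
      walk-snoc (x ∷ xs , u∈S ∷ all , (u~x , chain) , end) w~v v∈S
        with walk-snoc (xs , all , chain , end) w~v v∈S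
      ... | ys , all′ , chain′ , end′ = (x ∷ ys) , (u∈S ∷ all′) , (u~x , chain′) , end′

    connected : r ∈ S → (∀ w → w ∈ S → ¬ w ≡ r → parent w ∈ S) → ConnectedOn graph S
    connected r∈S closed u v u∈S v∈S = up (suc (rank u)) u ≤-refl u∈S (down (suc (rank v)) v ≤-refl v∈S)
      where
      down : ∀ k v → rank v < k → v ∈ S → WalkIn graph S r v
      down (suc k) v rank<k v∈S with v ≟ r
      ... | yes refl = [] , (r∈S ∷ []) , tt , refl
      ... | no  v≢r  = walk-snoc (down k (parent v) (≤-trans (rank-parent v v≢r) (≤-pred rank<k)) (closed v v∈S v≢r))
                                 (Adj⁺ (parent v) v (inj₂ (v≢r , refl))) v∈S
      up : ∀ k u → rank u < k → u ∈ S → WalkIn graph S r v → WalkIn graph S u v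
      up (suc k) u rank<k u∈S r⇝v with u ≟ r
      ... | yes refl = r⇝v
      ... | no  u≢r  = walk-cons u∈S (Adj⁺ u (parent u) (inj₁ (u≢r , refl)))
                                 (up k (parent u) (≤-trans (rank-parent u u≢r) (≤-pred rank<k)) (closed u u∈S u≢r) r⇝v)

  private
    penultimate : Fin n → Fin n → List (Fin n) → Fin n
    penultimate x y []       = x
    penultimate x y (z ∷ zs) = penultimate y z zs

    penultimate∈ : ∀ x y zs → penultimate x y zs ∈ₗ x ∷ y ∷ zs
    penultimate∈ x y []       = here refl
    penultimate∈ x y (z ∷ zs) = there (penultimate∈ y z zs)

    last∈ : ∀ (y : Fin n) ys → last y ys ∈ₗ y ∷ ys
    last∈ y []       = here refl
    last∈ y (z ∷ zs) = there (last∈ z zs)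

    last-step : ∀ x y zs → AdjChain graph (x ∷ y ∷ zs) → Adj graph (penultimate x y zs) (last y zs)
    last-step x y []       (x~y , _)   = x~y
    last-step x y (z ∷ zs) (_ , chain) = last-step y z zs chain

    head∉tail : ∀ {x w : Fin n} {xs} → Unique (x ∷ xs) → w ∈ₗ xs → ¬ x ≡ w
    head∉tail (x∉xs ∷ _) w∈xs = All.lookup x∉xs w∈xs

    tail-unique : ∀ {x : Fin n} {xs} → Unique (x ∷ xs) → Unique xs
    tail-unique (_ ∷ unique) = unique

    -- On a path without repeated vertices, a step from a parent down to its child can only be
    -- followed by further steps down, since the next vertex cannot be the parent again.
    descending : ∀ x y ys → Unique (x ∷ y ∷ ys) → AdjChain graph (x ∷ y ∷ ys) → ChildOf y x →
                 rank x < rank (last y ys) × ChildOf (last y ys) (penultimate x y ys)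
    descending x y []       _      _             y↓x = child-rank y↓x , y↓x
    descending x y (z ∷ zs) unique (_ , chain) y↓x with Adj⁻ y z (proj₁ chain)
    ... | inj₁ y↑z = ⊥-elim (head∉tail unique (there (here refl)) (parent-unique y↓x y↑z))
    ... | inj₂ z↓y with descending y z zs (tail-unique unique) chain z↓y
    ...   | rank< , last↓ = <-trans (child-rank y↓x) rank< , last↓

    ascending : ∀ x y ys → Unique (x ∷ y ∷ ys) → AdjChain graph (x ∷ y ∷ ys) →
                ChildOf (penultimate x y ys) (last y ys) → rank (last y ys) < rank x × ChildOf x y
    ascending x y []       _      _               x↑y = child-rank x↑y , x↑y
    ascending x y (z ∷ zs) unique (x~y , chain) up with ascending y z zs (tail-unique unique) chain up
    ... | rank< , y↑z with Adj⁻ x y x~y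
    ...   | inj₁ x↑y = <-trans rank< (child-rank x↑y) , x↑y
    ...   | inj₂ y↓x = ⊥-elim (head∉tail unique (there (here refl)) (parent-unique y↓x y↑z))

  acyclic : ∀ S → ¬ CycleIn graph S
  acyclic S (x , [] , () , _)
  acyclic S (x , y ∷ [] , s≤s () , _)
  acyclic S (x , y ∷ z ∷ zs , _ , unique , _ , (x~y , chain) , closing)
    with Adj⁻ x y x~y | Adj⁻ (last z zs) x closing
  ... | inj₂ y↓x | inj₁ last↑x =
    head∉tail unique (penultimate∈ y z zs) (parent-unique last↑x (proj₂ (descending x y (z ∷ zs) unique (x~y , chain) y↓x)))
  ... | inj₂ y↓x | inj₂ x↑last = <-asym (proj₁ (descending x y (z ∷ zs) unique (x~y , chain) y↓x)) (child-rank x↑last)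
  ... | inj₁ x↑y | inj₂ x↑last = head∉tail (tail-unique unique) (last∈ z zs) (parent-unique x↑y x↑last)
  ... | inj₁ x↑y | inj₁ last↑x with Adj⁻ (penultimate y z zs) (last z zs) (last-step y z zs chain)
  ...   | inj₂ last↑pen = head∉tail unique (penultimate∈ y z zs) (parent-unique last↑x last↑pen)
  ...   | inj₁ pen↑last =
    <-asym (<-trans (child-rank x↑y) (child-rank last↑x)) (proj₁ (ascending y z zs (tail-unique unique) chain pen↑last))

  tree-on : ∀ S → r ∈ S → (∀ w → w ∈ S → ¬ w ≡ r → parent w ∈ S) → IsTreeOn graph S
  tree-on S r∈S closed = (r , r∈S) , connected S r∈S closed , acyclic S

  isTree : IsTree graph
  isTree = tree-on ⊤ ∈⊤ (λ _ _ _ → ∈⊤)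

-- Each vertex outside U is a leaf hanging from the spine vertex host x.
module Caterpillar {n} (U : Fin n → Bool) (two-inner : 2 ≤ count U)
                   (host : Fin n → Fin n) (host-inner : ∀ x → ¬ T (U x) → T (U (host x))) where

  open Spine U two-inner

  parent : Fin n → Fin n
  parent w with U w
  ... | true  = next w
  ... | false = host w

  rank : Fin n → ℕ
  rank w with U w
  ... | true  = n ∸ toℕ w
  ... | false = suc n

  parent-inner : ∀ w → T (U w) → parent w ≡ next w
  parent-inner w uw with U w
  ... | true = refl

  parent-leaf : ∀ w → ¬ T (U w) → parent w ≡ host w
  parent-leaf w ¬uw with U w
  ... | true  = ⊥-elim (¬uw tt)
  ... | false = refl

  rank-inner : ∀ w → T (U w) → rank w ≡ n ∸ toℕ w
  rank-inner w uw with U w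
  ... | true = refl

  rank-leaf : ∀ w → ¬ T (U w) → rank w ≡ suc n
  rank-leaf w ¬uw with U w
  ... | true  = ⊥-elim (¬uw tt)
  ... | false = refl

  parent-is-inner : ∀ w → ¬ w ≡ r → T (U (parent w))
  parent-is-inner w w≢r with T? (U w)
  ... | yes uw = subst (T ∘ U) (sym (parent-inner w uw)) (next-inner w uw w≢r)
  ... | no ¬uw = subst (T ∘ U) (sym (parent-leaf w ¬uw)) (host-inner w ¬uw)

  rank-parent : ∀ w → ¬ w ≡ r → rank (parent w) < rank w
  rank-parent w w≢r with T? (U w)
  ... | yes uw = subst₂ _<_ (sym (trans (cong rank (parent-inner w uw)) (rank-inner _ (next-inner w uw w≢r))))
                            (sym (rank-inner w uw))
                            (∸-monoʳ-< (next-> w uw w≢r) (<⇒≤ (toℕ<n (next w))))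
  ... | no ¬uw = subst₂ _<_ (sym (rank-inner (parent w) (parent-is-inner w w≢r))) (sym (rank-leaf w ¬uw))
                            (s≤s (m∸n≤m n (toℕ (parent w))))

  open ParentTree r parent rank rank-parent public
    renaming (graph to caterpillar)

  hostedBy : Fin n → Fin n → Bool
  hostedBy v = ∁ᵇ U ∩ᵇ (⁅ v ⁆ᵇ ∘ host)

  private
    Children : Fin n → Fin n → Bool
    Children v w = isChild w v

    inner-children : ∀ v → count (Children v ∩ᵇ U) ≡ bit ((U ─ᵇ ⁅ a ⁆ᵇ) v)
    inner-children v with T? ((U ─ᵇ ⁅ a ⁆ᵇ) v)
    ... | yes uv-a = trans (count-unique (Children v ∩ᵇ U) (∩ᵇ⁺ (isChild⁺ p v (p≢r , trans (parent-inner p up) next-p)) up) unique)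
                           (sym (bit-true uv-a))
      where
      previous-v = previous v (─ᵇ⁻ˡ uv-a) (─ᵇ⁻ʳ uv-a ∘ ⁅⁆ᵇ⁺ ∘ sym)
      p      = proj₁ previous-v
      up     = proj₁ (proj₂ previous-v)
      p≢r    = proj₁ (proj₂ (proj₂ previous-v))
      next-p = proj₂ (proj₂ (proj₂ previous-v))
      unique : ∀ w → T ((Children v ∩ᵇ U) w) → w ≡ p
      unique w child with isChild⁻ w v (∩ᵇ⁻ˡ child)
      ... | w≢r , parent≡v = next-injective w p (∩ᵇ⁻ʳ child) w≢r up p≢r
                               (trans (sym (parent-inner w (∩ᵇ⁻ʳ child))) (trans parent≡v (sym next-p)))
    ... | no ¬uv-a = trans (count-none (Children v ∩ᵇ U) none) (sym (bit-false ¬uv-a))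
      where
      none : ∀ w → ¬ T ((Children v ∩ᵇ U) w)
      none w child with isChild⁻ w v (∩ᵇ⁻ˡ child)
      ... | w≢r , parent≡v with trans (sym (parent-inner w (∩ᵇ⁻ʳ child))) parent≡v
      ...   | next≡v = ¬uv-a (─ᵇ⁺ (subst (T ∘ U) next≡v (next-inner w (∩ᵇ⁻ʳ child) w≢r))
                                  (next≢a w (∩ᵇ⁻ʳ child) w≢r ∘ trans next≡v ∘ sym ∘ ⁅⁆ᵇ⁻))

    leaf-children : ∀ v → count (Children v ─ᵇ U) ≡ count (hostedBy v)
    leaf-children v = count-cong (Children v ─ᵇ U) (hostedBy v)
      (λ w child → ∩ᵇ⁺ (∁ᵇ⁺ (─ᵇ⁻ʳ child))
                       (⁅⁆ᵇ⁺ (sym (trans (sym (parent-leaf w (─ᵇ⁻ʳ child))) (proj₂ (isChild⁻ w v (─ᵇ⁻ˡ child)))))))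
      (λ w hosted → ─ᵇ⁺ (isChild⁺ w v (leaf≢r (∁ᵇ⁻ (∩ᵇ⁻ˡ hosted)) ,
                                        trans (parent-leaf w (∁ᵇ⁻ (∩ᵇ⁻ˡ hosted))) (sym (⁅⁆ᵇ⁻ (∩ᵇ⁻ʳ hosted)))))
                        (∁ᵇ⁻ (∩ᵇ⁻ˡ hosted)))
      where
      leaf≢r : ∀ {w} → ¬ T (U w) → ¬ w ≡ r
      leaf≢r ¬uw refl = ¬uw r-inner

  degree-caterpillar : ∀ v → degree caterpillar v ≡ skeleton v + count (hostedBy v)
  degree-caterpillar v = begin
    degree caterpillar v
      ≡⟨ degree-graph v ⟩
    bit (∁ᵇ ⁅ r ⁆ᵇ v) + count (Children v)
      ≡⟨ cong (bit (∁ᵇ ⁅ r ⁆ᵇ v) +_) (count-∩ᵇ-─ᵇ (Children v) U) ⟩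
    bit (∁ᵇ ⁅ r ⁆ᵇ v) + (count (Children v ∩ᵇ U) + count (Children v ─ᵇ U))
      ≡⟨ cong (bit (∁ᵇ ⁅ r ⁆ᵇ v) +_) (cong₂ _+_ (inner-children v) (leaf-children v)) ⟩
    bit (∁ᵇ ⁅ r ⁆ᵇ v) + (bit ((U ─ᵇ ⁅ a ⁆ᵇ) v) + count (hostedBy v))
      ≡⟨ +-assoc (bit (∁ᵇ ⁅ r ⁆ᵇ v)) _ _ ⟨
    skeleton v + count (hostedBy v) ∎
    where open ≡-Reasoning

  tree-on-⊇ : ∀ S → (∀ x → T (U x) → x ∈ S) → IsTreeOn caterpillar S
  tree-on-⊇ S U⊆S = tree-on S (U⊆S r r-inner) (λ w _ w≢r → U⊆S _ (parent-is-inner w w≢r))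

  leaf-neighbour : ∀ {c x} → ¬ T (U x) → Adj caterpillar c x → c ≡ host x
  leaf-neighbour {c} {x} ¬ux c~x with Adj⁻ c x c~x
  ... | inj₁ (c≢r , parent≡x) = ⊥-elim (¬ux (subst (T ∘ U) parent≡x (parent-is-inner c c≢r)))
  ... | inj₂ (_ , parent≡c)  = trans (sym parent≡c) (parent-leaf x ¬ux)

  a≁r : 3 ≤ count U → ¬ Adj caterpillar a r
  a≁r three a~r with Adj⁻ a r a~r
  ... | inj₁ (_ , parent≡r) = <⇒≱ three (short-spine₂ (trans (sym (parent-inner a a-inner)) parent≡r))
  ... | inj₂ (r≢r , _)      = r≢r refl

  a,r-no-common-neighbour : 4 ≤ count U → ∀ c → Adj caterpillar c a → Adj caterpillar c r → ⊥
  a,r-no-common-neighbour four c c~a c~r with Adj⁻ c r c~r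
  ... | inj₂ (r≢r , _) = r≢r refl
  ... | inj₁ (c≢r , parent-c≡r) with Adj⁻ c a c~a
  ...   | inj₁ (_ , parent-c≡a) = a≢r (trans (sym parent-c≡a) parent-c≡r)
  ...   | inj₂ (_ , parent-a≡c) = <⇒≱ four (short-spine₃ (c≢r ∘ trans (sym next-a≡c)) next²-a≡r)
    where
    next-a≡c : next a ≡ c
    next-a≡c = trans (sym (parent-inner a a-inner)) parent-a≡c
    c-inner : T (U c)
    c-inner = subst (T ∘ U) next-a≡c (next-inner a a-inner a≢r)
    next²-a≡r : next (next a) ≡ r
    next²-a≡r = trans (cong next next-a≡c) (trans (sym (parent-inner c c-inner)) parent-c≡r)

  ¬star-long-spine : 4 ≤ count U → ∀ S → (∀ x → T (U x) → x ∈ S) → ¬ IsStarOn caterpillar S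
  ¬star-long-spine four S U⊆S =
    ¬star caterpillar S a r (U⊆S a a-inner) (U⊆S r r-inner) a≢r (a≁r (≤-trans (n≤1+n 3) four))
          (a,r-no-common-neighbour four)

  ¬star-leaf : ∀ S x y → x ∈ S → y ∈ S → ¬ T (U x) → T (U y) → ¬ host x ≡ y →
               ¬ Adj caterpillar (host x) y → ¬ IsStarOn caterpillar S
  ¬star-leaf S x y x∈S y∈S ¬ux uy host≢y host≁y =
    ¬star caterpillar S x y x∈S y∈S x≢y x≁y no-common
    where
    x≢y : ¬ x ≡ y
    x≢y refl = ¬ux uy
    x≁y : ¬ Adj caterpillar x y
    x≁y x~y = host≢y (sym (leaf-neighbour ¬ux (Adj-sym caterpillar x~y)))
    no-common : ∀ c → Adj caterpillar c x → Adj caterpillar c y → ⊥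
    no-common c c~x c~y = host≁y (subst (λ z → Adj caterpillar z y) (leaf-neighbour ¬ux c~x) c~y)

  ¬star-two-leaves : ∀ S x y → x ∈ S → y ∈ S → ¬ T (U x) → ¬ T (U y) → ¬ host x ≡ host y →
                     ¬ IsStarOn caterpillar S
  ¬star-two-leaves S x y x∈S y∈S ¬ux ¬uy hosts≢ =
    ¬star caterpillar S x y x∈S y∈S (hosts≢ ∘ cong host) x≁y no-common
    where
    x≁y : ¬ Adj caterpillar x y
    x≁y x~y = ¬ux (subst (T ∘ U) (sym (leaf-neighbour ¬uy x~y)) (host-inner y ¬uy))
    no-common : ∀ c → Adj caterpillar c x → Adj caterpillar c y → ⊥
    no-common c c~x c~y = hosts≢ (trans (sym (leaf-neighbour ¬ux c~x)) (leaf-neighbour ¬uy c~y))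

T⇒∈ : ∀ {n} {p : Subset n} {x} → T (lookup p x) → x ∈ p
T⇒∈ {p = p} {x} t = lookup⇒[]= x p (T⇒≡true t)
  where
  T⇒≡true : ∀ {b} → T b → b ≡ true
  T⇒≡true {true} _ = refl

∣∣≡count : ∀ {n} (p : Subset n) → ∣ p ∣ ≡ count (lookup p)
∣∣≡count p = trans (cong ∣_∣ (sym (tabulate∘lookup p))) (∣tabulate∣≡count (lookup p))

module Construction (n m : ℕ) (d : Fin n → ℕ) (tree-degrees : IsTreeDegreeSeq d) (m<n : m < n)
  (Vs : Fin (m ∸ 1) → Subset n) (Vs⊆L : ∀ j → Vs j ⊆ leafSet d)
  (Vs-disjoint : ∀ j k → ¬ (j ≡ k) → Empty (Vs j ∩ Vs k))
  (1<∣U∣ : 1 < ∣ innerSet d ∣) (1<∣Vs∣ : ∀ j → 1 < ∣ Vs j ∣) (d≤n∸m : ∀ i → d i ≤ n ∸ m) where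

  U L : Fin n → Bool
  U i = 1 <ᵇ d i
  L = ∁ᵇ U

  inner⇒2≤d : ∀ {v} → T (U v) → 2 ≤ d v
  inner⇒2≤d {v} = <ᵇ⇒< 1 (d v)

  leaf⇒d≡1 : ∀ {v} → ¬ T (U v) → d v ≡ 1
  leaf⇒d≡1 {v} ¬uv = ≤-antisym (≮⇒≥ (¬uv ∘ <⇒<ᵇ)) (proj₁ tree-degrees v)

  U⊆innerSet : ∀ {x} → T (U x) → x ∈ innerSet d
  U⊆innerSet {x} ux = T⇒∈ (subst T (sym (lookup∘tabulate U x)) ux)

  two-inner : 2 ≤ count U
  two-inner = subst (2 ≤_) (∣tabulate∣≡count U) 1<∣U∣

  open Spine U two-inner

  n≡U+L : count U + count L ≡ n
  n≡U+L = count-complement U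

  capacity : Fin n → ℕ
  capacity v = d v ∸ skeleton v

  skeleton≤d : ∀ v → skeleton v ≤ d v
  skeleton≤d v with T? (U v)
  ... | yes uv = ≤-trans (skeleton≤2 v) (inner⇒2≤d uv)
  ... | no ¬uv = subst (_≤ d v) (sym (skeleton-leaf v ¬uv)) (proj₁ tree-degrees v)

  -- Σ d = 2n − 2 and Σ skeleton = (n − 1) + (|U| − 1) leave exactly |L| for the leaves.
  Σcapacity : sumF capacity ≡ count L
  Σcapacity = +-cancelʳ-≡ (A + B + 2) (sumF capacity) (count L) (begin
    sumF capacity + (A + B + 2)         ≡⟨ regroup (sumF capacity) A B ⟩
    sumF capacity + (A + B) + 2         ≡⟨ cong (λ s → sumF capacity + s + 2) Σskeleton ⟨
    sumF capacity + sumF skeleton + 2   ≡⟨ cong (_+ 2) Σd ⟨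
    sumF d + 2                          ≡⟨ proj₂ tree-degrees ⟩
    n + n                               ≡⟨ cong₂ _+_ (sym n≡1+A) (trans (sym n≡U+L) (cong (_+ count L) U≡1+B)) ⟩
    (1 + A) + ((1 + B) + count L)       ≡⟨ regroup′ A B (count L) ⟩
    count L + (A + B + 2)               ∎)
    where
    open ≡-Reasoning
    A = count (∁ᵇ ⁅ r ⁆ᵇ)
    B = count (U ─ᵇ ⁅ a ⁆ᵇ)
    regroup : ∀ c x y → c + (x + y + 2) ≡ c + (x + y) + 2
    regroup = solve-∀
    regroup′ : ∀ x y l → (1 + x) + ((1 + y) + l) ≡ l + (x + y + 2)
    regroup′ = solve-∀
    Σd : sumF d ≡ sumF capacity + sumF skeleton
    Σd = trans (sumF-cong d _ (λ v → sym (m∸n+n≡m (skeleton≤d v)))) (sumF-+ capacity skeleton)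
    Σskeleton : sumF skeleton ≡ A + B
    Σskeleton = trans (sumF-+ (bit ∘ ∁ᵇ ⁅ r ⁆ᵇ) (bit ∘ (U ─ᵇ ⁅ a ⁆ᵇ)))
                      (cong₂ _+_ (sumF-bit (∁ᵇ ⁅ r ⁆ᵇ)) (sumF-bit (U ─ᵇ ⁅ a ⁆ᵇ)))
    n≡1+A : 1 + A ≡ n
    n≡1+A = trans (cong (_+ A) (sym (count-⁅⁆ᵇ r))) (count-complement ⁅ r ⁆ᵇ)
    U≡1+B : count U ≡ 1 + B
    U≡1+B = trans (count-─ᵇ U ⁅ a ⁆ᵇ (λ x a≡x → subst (T ∘ U) (⁅⁆ᵇ⁻ a≡x) a-inner)) (cong (_+ B) (count-⁅⁆ᵇ a))

  ca cr : ℕ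
  ca = capacity a
  cr = capacity r

  ca+1≡da : ca + 1 ≡ d a
  ca+1≡da = trans (cong (λ s → d a ∸ s + 1) skeleton-a) (m∸n+n≡m (proj₁ tree-degrees a))

  cr+1≡dr : cr + 1 ≡ d r
  cr+1≡dr = trans (cong (λ s → d r ∸ s + 1) skeleton-r) (m∸n+n≡m (proj₁ tree-degrees r))

  interior-capacity : Fin n → ℕ
  interior-capacity = erase r (erase a capacity)

  count-L : count L ≡ ca + (cr + sumF interior-capacity)
  count-L = begin
    count L                                               ≡⟨ Σcapacity ⟨
    sumF capacity                                         ≡⟨ sumF-erase a capacity ⟩
    ca + sumF (erase a capacity)                          ≡⟨ cong (ca +_) (sumF-erase r (erase a capacity)) ⟩
    ca + (erase a capacity r + sumF interior-capacity)    ≡⟨ cong (λ c → ca + (c + sumF interior-capacity)) (erase-≢ a r capacity a≢r) ⟩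
    ca + (cr + sumF interior-capacity)                    ∎
    where open ≡-Reasoning

  interior-capacity-support : ∀ v → 1 ≤ interior-capacity v → T (interior v)
  interior-capacity-support v pos = by-cases (r ≟ v) (a ≟ v) (T? (U v))
    where
    by-cases : Dec (r ≡ v) → Dec (a ≡ v) → Dec (T (U v)) → T (interior v)
    by-cases (yes refl) _ _ = ⊥-elim (1+n≰n (subst (1 ≤_) (erase-self r (erase a capacity)) pos))
    by-cases (no r≢v) (yes refl) _ =
      ⊥-elim (1+n≰n (subst (1 ≤_) (trans (erase-≢ r a (erase a capacity) r≢v) (erase-self a capacity)) pos))
    by-cases (no r≢v) (no a≢v) (no ¬uv) = ⊥-elim (1+n≰n (subst (1 ≤_) leaf-capacity pos))
      where
      leaf-capacity : interior-capacity v ≡ 0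
      leaf-capacity = trans (erase-≢ r v (erase a capacity) r≢v) (trans (erase-≢ a v capacity a≢v)
                        (cong₂ _∸_ (leaf⇒d≡1 ¬uv) (skeleton-leaf v ¬uv)))
    by-cases (no r≢v) (no a≢v) (yes uv) = ─ᵇ⁺ (─ᵇ⁺ uv (a≢v ∘ ⁅⁆ᵇ⁻)) (r≢v ∘ ⁅⁆ᵇ⁻)

  interior-capacity-bound : ∀ v → interior-capacity v ≤ bit (interior v) * ((n ∸ m) ∸ 2)
  interior-capacity-bound v with T? (interior v)
  ... | yes iv = begin
    interior-capacity v           ≡⟨ trans (erase-≢ r v (erase a capacity) (─ᵇ⁻ʳ iv ∘ ⁅⁆ᵇ⁺))
                                           (erase-≢ a v capacity (─ᵇ⁻ʳ (─ᵇ⁻ˡ iv) ∘ ⁅⁆ᵇ⁺)) ⟩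
    d v ∸ skeleton v              ≡⟨ cong (d v ∸_) (skeleton-interior v iv) ⟩
    d v ∸ 2                       ≤⟨ ∸-monoˡ-≤ 2 (d≤n∸m v) ⟩
    (n ∸ m) ∸ 2                   ≡⟨ *-identityˡ _ ⟨
    1 * ((n ∸ m) ∸ 2)             ≡⟨ cong (_* _) (bit-true iv) ⟨
    bit (interior v) * ((n ∸ m) ∸ 2) ∎
    where open ≤-Reasoning
  ... | no ¬iv with interior-capacity v in eq
  ...   | zero  = z≤n
  ...   | suc _ = ⊥-elim (¬iv (interior-capacity-support v (subst (1 ≤_) (sym eq) (s≤s z≤n))))

  Σinterior-capacity : sumF interior-capacity ≤ count interior * ((n ∸ m) ∸ 2)
  Σinterior-capacity = ≤-trans (sumF-mono _ _ interior-capacity-bound) (≤-reflexive (sumF-bit-* interior _))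

  private
    n∸m-bound : ∀ x y → x + y ≡ n → x ≤ n ∸ m → m ≤ y
    n∸m-bound x y x+y≡n x≤n∸m = +-cancelˡ-≤ x m y (begin
      x + m         ≤⟨ +-monoˡ-≤ m x≤n∸m ⟩
      n ∸ m + m     ≡⟨ m∸n+n≡m (<⇒≤ m<n) ⟩
      n             ≡⟨ x+y≡n ⟨
      x + y         ∎)
      where open ≤-Reasoning

  spine₂⇒Σinterior-capacity≡0 : count U ≡ 2 → sumF interior-capacity ≡ 0
  spine₂⇒Σinterior-capacity≡0 k≡2 = n≤0⇒n≡0 (≤-trans Σinterior-capacity (≤-reflexive (cong (_* ((n ∸ m) ∸ 2)) no-interior)))
    where
    no-interior : count interior ≡ 0
    no-interior = +-cancelˡ-≡ 2 (count interior) 0 (trans count-interior k≡2)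

  -- With a spine of two vertices every leaf hangs from a or r, so d a + d r = n.
  spine₂⇒m≤ends : count U ≡ 2 → m ≤ d a × m ≤ d r
  spine₂⇒m≤ends k≡2 = n∸m-bound (d r) (d a) (trans (+-comm (d r) (d a)) da+dr≡n) (d≤n∸m r)
                    , n∸m-bound (d a) (d r) da+dr≡n (d≤n∸m a)
    where
    Σic≡0 = spine₂⇒Σinterior-capacity≡0 k≡2
    da+dr≡n : d a + d r ≡ n
    da+dr≡n = begin
      d a + d r                                    ≡⟨ cong₂ _+_ ca+1≡da cr+1≡dr ⟨
      (ca + 1) + (cr + 1)                          ≡⟨ regroup ca cr ⟩
      2 + (ca + (cr + 0))                          ≡⟨ cong₂ (λ k s → k + (ca + (cr + s))) k≡2 Σic≡0 ⟨
      count U + (ca + (cr + sumF interior-capacity)) ≡⟨ cong (count U +_) count-L ⟨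
      count U + count L                            ≡⟨ n≡U+L ⟩
      n ∎
      where
      open ≡-Reasoning
      regroup : ∀ x y → (x + 1) + (y + 1) ≡ 2 + (x + (y + 0))
      regroup = solve-∀

  -- With a spine of three vertices only the middle one takes leaves besides a and r, at most n − m − 2.
  spine₃⇒m∸1≤ca+cr : count U ≡ 3 → m ∸ 1 ≤ ca + cr
  spine₃⇒m∸1≤ca+cr k≡3 = ≤-trans (∸-monoˡ-≤ 1 m≤) (≤-reflexive (m+n∸n≡m (ca + cr) 1))
    where
    C = (n ∸ m) ∸ 2
    one-interior : count interior ≡ 1
    one-interior = +-cancelˡ-≡ 2 (count interior) 1 (trans count-interior k≡3)
    Σic≤C : sumF interior-capacity ≤ C
    Σic≤C = ≤-trans Σinterior-capacity (≤-reflexive (trans (cong (_* C) one-interior) (*-identityˡ C)))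
    C+2+m≡n : C + 2 + m ≡ n
    C+2+m≡n = trans (cong (_+ m) (m∸n+n≡m (≤-trans (inner⇒2≤d a-inner) (d≤n∸m a)))) (m∸n+n≡m (<⇒≤ m<n))
    m≤ : m ≤ ca + cr + 1
    m≤ = +-cancelˡ-≤ (C + 2) m (ca + cr + 1) (begin
      C + 2 + m                                      ≡⟨ C+2+m≡n ⟩
      n                                              ≡⟨ n≡U+L ⟨
      count U + count L                              ≡⟨ cong₂ _+_ k≡3 count-L ⟩
      3 + (ca + (cr + sumF interior-capacity))       ≤⟨ +-monoʳ-≤ 3 (+-monoʳ-≤ ca (+-monoʳ-≤ cr Σic≤C)) ⟩
      3 + (ca + (cr + C))                            ≡⟨ regroup ca cr C ⟩
      C + 2 + (ca + cr + 1)                          ∎)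
      where
      open ≤-Reasoning
      regroup : ∀ x y c → 3 + (x + (y + c)) ≡ c + 2 + (x + y + 1)
      regroup = solve-∀

  private
    Vb : Fin (m ∸ 1) → Fin n → Bool
    Vb j = lookup (Vs j)

    two-in-Vs : ∀ j → Σ (Fin n) λ x → Σ (Fin n) λ y → ¬ x ≡ y × T (Vb j x) × T (Vb j y)
    two-in-Vs j = two-witnesses (Vb j) (subst (2 ≤_) (∣∣≡count (Vs j)) (1<∣Vs∣ j))

  rep₁ rep₂ : Fin (m ∸ 1) → Fin n
  rep₁ j = proj₁ (two-in-Vs j)
  rep₂ j = proj₁ (proj₂ (two-in-Vs j))

  rep₁∈Vs : ∀ j → rep₁ j ∈ Vs j
  rep₁∈Vs j = T⇒∈ (proj₁ (proj₂ (proj₂ (proj₂ (two-in-Vs j)))))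

  rep₂∈Vs : ∀ j → rep₂ j ∈ Vs j
  rep₂∈Vs j = T⇒∈ (proj₂ (proj₂ (proj₂ (proj₂ (two-in-Vs j)))))

  Vs-leaf : ∀ j {x} → x ∈ Vs j → ¬ T (U x)
  Vs-leaf j x∈Vs ux = x∈∁p⇒x∉p (Vs⊆L j x∈Vs) (U⊆innerSet ux)

  R Q : Fin n → Bool
  R = image rep₁
  Q = image rep₂

  R⊆L : R ⊆ᵇ L
  R⊆L x x∈R with image⁻ x∈R
  ... | j , refl = ∁ᵇ⁺ (Vs-leaf j (rep₁∈Vs j))

  Q⊆L : Q ⊆ᵇ L
  Q⊆L x x∈Q with image⁻ x∈Q
  ... | j , refl = ∁ᵇ⁺ (Vs-leaf j (rep₂∈Vs j))

  R∩Q≡∅ : ∀ x → T (R x) → ¬ T (Q x)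
  R∩Q≡∅ x x∈R x∈Q with image⁻ x∈R | image⁻ x∈Q
  ... | i , refl | j , rep₂j≡x with i ≟ j
  ...   | yes refl = proj₁ (proj₂ (proj₂ (two-in-Vs i))) (sym rep₂j≡x)
  ...   | no  i≢j  = Vs-disjoint i j i≢j (rep₁ i , x∈p∩q⁺ (rep₁∈Vs i , subst (_∈ Vs j) rep₂j≡x (rep₂∈Vs j)))

  private
    m∸1≤ : ∀ {x c} → m ≤ x → c + 1 ≡ x → m ∸ 1 ≤ c
    m∸1≤ {x} {c} m≤x c+1≡x = ≤-trans (∸-monoˡ-≤ 1 (subst (m ≤_) (sym c+1≡x) m≤x)) (≤-reflexive (m+n∸n≡m c 1))

    candidates-for-a : Dec (count U ≡ 2) → Fin n → Bool
    candidates-for-a (yes _) = L ─ᵇ Q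
    candidates-for-a (no  _) = L

  -- On a spine of two vertices the representatives rep₂ j are reserved for r.
  Xa : Fin n → Bool
  Xa = candidates-for-a (count U ℕ.≟ 2)

  private
    Xa⊆L′ : ∀ k? → candidates-for-a k? ⊆ᵇ L
    Xa⊆L′ (yes _) x = ─ᵇ⁻ˡ
    Xa⊆L′ (no  _) x = λ l → l

    L─Q⊆Xa′ : ∀ k? x → T (L x) → ¬ T (Q x) → T (candidates-for-a k? x)
    L─Q⊆Xa′ (yes _) x l ¬q = ─ᵇ⁺ l ¬q
    L─Q⊆Xa′ (no  _) x l _  = l

    Xa-avoids-Q′ : ∀ k? → count U ≡ 2 → ∀ x → T (candidates-for-a k? x) → ¬ T (Q x)
    Xa-avoids-Q′ (yes _)   _   x = ─ᵇ⁻ʳ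
    Xa-avoids-Q′ (no  k≢2) k≡2 x = ⊥-elim (k≢2 k≡2)

    L⊆Xa′ : ∀ k? → ¬ count U ≡ 2 → L ⊆ᵇ candidates-for-a k?
    L⊆Xa′ (yes k≡2) k≢2 = ⊥-elim (k≢2 k≡2)
    L⊆Xa′ (no  _)   _   = λ _ l → l

    ca≤Xa′ : ∀ k? → ca ≤ count (candidates-for-a k?)
    ca≤Xa′ (no _)    = ≤-trans (m≤m+n ca _) (≤-reflexive (sym count-L))
    ca≤Xa′ (yes k≡2) = +-cancelʳ-≤ (count Q) ca (count (L ─ᵇ Q)) (begin
      ca + count Q                    ≤⟨ +-monoʳ-≤ ca (≤-trans (count-image rep₂) (m∸1≤ (proj₂ (spine₂⇒m≤ends k≡2)) cr+1≡dr)) ⟩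
      ca + cr                         ≤⟨ +-monoʳ-≤ ca (m≤m+n cr _) ⟩
      ca + (cr + sumF interior-capacity) ≡⟨ count-L ⟨
      count L                         ≡⟨ count-─ᵇ L Q Q⊆L ⟩
      count Q + count (L ─ᵇ Q)        ≡⟨ +-comm (count Q) _ ⟩
      count (L ─ᵇ Q) + count Q        ∎)
      where open ≤-Reasoning

  Xa⊆L : Xa ⊆ᵇ L
  Xa⊆L = Xa⊆L′ (count U ℕ.≟ 2)

  L─Q⊆Xa : ∀ x → T (L x) → ¬ T (Q x) → T (Xa x)
  L─Q⊆Xa = L─Q⊆Xa′ (count U ℕ.≟ 2)

  Xa-avoids-Q : count U ≡ 2 → ∀ x → T (Xa x) → ¬ T (Q x)
  Xa-avoids-Q = Xa-avoids-Q′ (count U ℕ.≟ 2)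

  L⊆Xa : ¬ count U ≡ 2 → L ⊆ᵇ Xa
  L⊆Xa = L⊆Xa′ (count U ℕ.≟ 2)

  private
    block-a = choose-preferring Xa R ca (ca≤Xa′ (count U ℕ.≟ 2))

  Ba : Fin n → Bool
  Ba = proj₁ block-a

  Ba⊆Xa : Ba ⊆ᵇ Xa
  Ba⊆Xa = proj₁ (proj₂ block-a)

  Ba⊆L : Ba ⊆ᵇ L
  Ba⊆L x = Xa⊆L x ∘ Ba⊆Xa x

  ∣Ba∣ : count Ba ≡ ca
  ∣Ba∣ = proj₁ (proj₂ (proj₂ block-a))

  Ba-takes-R : count (Xa ∩ᵇ R) ≤ ca → Xa ∩ᵇ R ⊆ᵇ Ba
  Ba-takes-R = proj₁ (proj₂ (proj₂ (proj₂ block-a)))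

  Ba-only-R : ca ≤ count (Xa ∩ᵇ R) → Ba ⊆ᵇ R
  Ba-only-R = proj₂ (proj₂ (proj₂ (proj₂ block-a)))

  Xr : Fin n → Bool
  Xr = L ─ᵇ Ba

  count-Xr : count Xr ≡ cr + sumF interior-capacity
  count-Xr = +-cancelˡ-≡ ca (count Xr) _ (trans (sym (trans (count-─ᵇ L Ba Ba⊆L) (cong (_+ count Xr) ∣Ba∣))) count-L)

  private
    block-r = choose-preferring Xr R cr (≤-trans (m≤m+n cr _) (≤-reflexive (sym count-Xr)))

  Br : Fin n → Bool
  Br = proj₁ block-r

  Br⊆Xr : Br ⊆ᵇ Xr
  Br⊆Xr = proj₁ (proj₂ block-r)

  ∣Br∣ : count Br ≡ cr
  ∣Br∣ = proj₁ (proj₂ (proj₂ block-r))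

  Br-takes-R : count (Xr ∩ᵇ R) ≤ cr → Xr ∩ᵇ R ⊆ᵇ Br
  Br-takes-R = proj₁ (proj₂ (proj₂ (proj₂ block-r)))

  X₃ : Fin n → Bool
  X₃ = Xr ─ᵇ Br

  count-X₃ : count X₃ ≡ sumF interior-capacity
  count-X₃ = +-cancelˡ-≡ cr (count X₃) _ (trans (sym (trans (count-─ᵇ Xr Br Br⊆Xr) (cong (_+ count X₃) ∣Br∣))) count-Xr)

  private
    assignment = assign interior-capacity X₃ r (sym count-X₃)

  own : Fin n → Fin n
  own = proj₁ assignment

  own-fibre : ∀ v → count (X₃ ∩ᵇ (⁅ v ⁆ᵇ ∘ own)) ≡ interior-capacity v
  own-fibre = proj₂ assignment

  private
    host-by : ∀ x → Dec (T (Ba x)) → Dec (T (Br x)) → Fin n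
    host-by x (yes _) _       = a
    host-by x (no  _) (yes _) = r
    host-by x (no  _) (no  _) = own x

  host : Fin n → Fin n
  host x = host-by x (T? (Ba x)) (T? (Br x))

  host-Ba : ∀ x → T (Ba x) → host x ≡ a
  host-Ba x ba = by-cases (T? (Ba x)) (T? (Br x))
    where
    by-cases : ∀ ba? br? → host-by x ba? br? ≡ a
    by-cases (yes _)   _ = refl
    by-cases (no  ¬ba) _ = ⊥-elim (¬ba ba)

  host-Br : ∀ x → T (Br x) → host x ≡ r
  host-Br x br = by-cases (T? (Ba x)) (T? (Br x))
    where
    by-cases : ∀ ba? br? → host-by x ba? br? ≡ r
    by-cases (yes ba) _         = ⊥-elim (─ᵇ⁻ʳ (Br⊆Xr x br) ba)
    by-cases (no  _)  (yes _)   = refl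
    by-cases (no  _)  (no  ¬br) = ⊥-elim (¬br br)

  host-X₃ : ∀ x → T (X₃ x) → host x ≡ own x
  host-X₃ x x₃ = by-cases (T? (Ba x)) (T? (Br x))
    where
    by-cases : ∀ ba? br? → host-by x ba? br? ≡ own x
    by-cases (yes ba) _        = ⊥-elim (─ᵇ⁻ʳ (─ᵇ⁻ˡ x₃) ba)
    by-cases (no  _)  (yes br) = ⊥-elim (─ᵇ⁻ʳ x₃ br)
    by-cases (no  _)  (no  _)  = refl

  leaf-blocks : ∀ x → T (L x) → T (Ba x) ⊎ T (Br x) ⊎ T (X₃ x)
  leaf-blocks x l = by-cases (T? (Ba x)) (T? (Br x))
    where
    by-cases : Dec (T (Ba x)) → Dec (T (Br x)) → T (Ba x) ⊎ T (Br x) ⊎ T (X₃ x)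
    by-cases (yes ba)  _         = inj₁ ba
    by-cases (no  _)   (yes br)  = inj₂ (inj₁ br)
    by-cases (no  ¬ba) (no  ¬br) = inj₂ (inj₂ (─ᵇ⁺ (─ᵇ⁺ l ¬ba) ¬br))

  own-interior : ∀ x → T (X₃ x) → T (interior (own x))
  own-interior x x₃ = interior-capacity-support (own x)
    (subst (1 ≤_) (own-fibre (own x)) (count-positive (X₃ ∩ᵇ (⁅ own x ⁆ᵇ ∘ own)) (∩ᵇ⁺ x₃ (⁅⁆ᵇ⁺ refl))))

  host-inner : ∀ x → ¬ T (U x) → T (U (host x))
  host-inner x ¬ux = by-cases (leaf-blocks x (∁ᵇ⁺ ¬ux))
    where
    by-cases : T (Ba x) ⊎ T (Br x) ⊎ T (X₃ x) → T (U (host x))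
    by-cases (inj₁ ba)        = subst (T ∘ U) (sym (host-Ba x ba)) a-inner
    by-cases (inj₂ (inj₁ br)) = subst (T ∘ U) (sym (host-Br x br)) r-inner
    by-cases (inj₂ (inj₂ x₃)) = subst (T ∘ U) (sym (host-X₃ x x₃)) (─ᵇ⁻ˡ (─ᵇ⁻ˡ (own-interior x x₃)))

  Hosted : Fin n → Fin n → Bool
  Hosted v = L ∩ᵇ (⁅ v ⁆ᵇ ∘ host)

  hosted-block : ∀ v x → T (Hosted v x) →
                 (T (Ba x) × v ≡ a) ⊎ (T (Br x) × v ≡ r) ⊎ (T (X₃ x) × v ≡ own x)
  hosted-block v x h = by-block (leaf-blocks x (∩ᵇ⁻ˡ h))
    where
    v≡host = ⁅⁆ᵇ⁻ (∩ᵇ⁻ʳ h)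
    by-block : T (Ba x) ⊎ T (Br x) ⊎ T (X₃ x) →
               (T (Ba x) × v ≡ a) ⊎ (T (Br x) × v ≡ r) ⊎ (T (X₃ x) × v ≡ own x)
    by-block (inj₁ ba)        = inj₁ (ba , trans v≡host (host-Ba x ba))
    by-block (inj₂ (inj₁ br)) = inj₂ (inj₁ (br , trans v≡host (host-Br x br)))
    by-block (inj₂ (inj₂ x₃)) = inj₂ (inj₂ (x₃ , trans v≡host (host-X₃ x x₃)))

  private
    own≢a : ∀ {x} → T (X₃ x) → ¬ a ≡ own x
    own≢a x₃ a≡own = ─ᵇ⁻ʳ (─ᵇ⁻ˡ (own-interior _ x₃)) (⁅⁆ᵇ⁺ a≡own)

    own≢r : ∀ {x} → T (X₃ x) → ¬ r ≡ own x
    own≢r x₃ r≡own = ─ᵇ⁻ʳ (own-interior _ x₃) (⁅⁆ᵇ⁺ r≡own)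

  hosted-by-a : count (Hosted a) ≡ ca
  hosted-by-a = trans (count-cong (Hosted a) Ba hosted⇒Ba Ba⇒hosted) ∣Ba∣
    where
    hosted⇒Ba : Hosted a ⊆ᵇ Ba
    hosted⇒Ba x h = case (hosted-block a x h)
      where
      case : _ → T (Ba x)
      case (inj₁ (ba , _))           = ba
      case (inj₂ (inj₁ (_ , a≡r)))   = ⊥-elim (a≢r a≡r)
      case (inj₂ (inj₂ (x₃ , a≡own))) = ⊥-elim (own≢a x₃ a≡own)
    Ba⇒hosted : Ba ⊆ᵇ Hosted a
    Ba⇒hosted x ba = ∩ᵇ⁺ (Ba⊆L x ba) (⁅⁆ᵇ⁺ (sym (host-Ba x ba)))

  hosted-by-r : count (Hosted r) ≡ cr
  hosted-by-r = trans (count-cong (Hosted r) Br hosted⇒Br Br⇒hosted) ∣Br∣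
    where
    hosted⇒Br : Hosted r ⊆ᵇ Br
    hosted⇒Br x h = case (hosted-block r x h)
      where
      case : _ → T (Br x)
      case (inj₁ (_ , r≡a))           = ⊥-elim (a≢r (sym r≡a))
      case (inj₂ (inj₁ (br , _)))     = br
      case (inj₂ (inj₂ (x₃ , r≡own))) = ⊥-elim (own≢r x₃ r≡own)
    Br⇒hosted : Br ⊆ᵇ Hosted r
    Br⇒hosted x br = ∩ᵇ⁺ (─ᵇ⁻ˡ (Br⊆Xr x br)) (⁅⁆ᵇ⁺ (sym (host-Br x br)))

  hosted-by-interior : ∀ v → ¬ a ≡ v → ¬ r ≡ v → count (Hosted v) ≡ capacity v
  hosted-by-interior v a≢v r≢v = begin
    count (Hosted v)                ≡⟨ count-cong (Hosted v) (X₃ ∩ᵇ (⁅ v ⁆ᵇ ∘ own)) hosted⇒X₃ X₃⇒hosted ⟩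
    count (X₃ ∩ᵇ (⁅ v ⁆ᵇ ∘ own))     ≡⟨ own-fibre v ⟩
    interior-capacity v             ≡⟨ trans (erase-≢ r v (erase a capacity) r≢v) (erase-≢ a v capacity a≢v) ⟩
    capacity v                      ∎
    where
    open ≡-Reasoning
    hosted⇒X₃ : Hosted v ⊆ᵇ X₃ ∩ᵇ (⁅ v ⁆ᵇ ∘ own)
    hosted⇒X₃ x h = case (hosted-block v x h)
      where
      case : _ → T ((X₃ ∩ᵇ (⁅ v ⁆ᵇ ∘ own)) x)
      case (inj₁ (_ , v≡a))           = ⊥-elim (a≢v (sym v≡a))
      case (inj₂ (inj₁ (_ , v≡r)))    = ⊥-elim (r≢v (sym v≡r))
      case (inj₂ (inj₂ (x₃ , v≡own))) = ∩ᵇ⁺ x₃ (⁅⁆ᵇ⁺ v≡own)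
    X₃⇒hosted : X₃ ∩ᵇ (⁅ v ⁆ᵇ ∘ own) ⊆ᵇ Hosted v
    X₃⇒hosted x p = ∩ᵇ⁺ (─ᵇ⁻ˡ (─ᵇ⁻ˡ (∩ᵇ⁻ˡ p))) (⁅⁆ᵇ⁺ (trans (⁅⁆ᵇ⁻ (∩ᵇ⁻ʳ p)) (sym (host-X₃ x (∩ᵇ⁻ˡ p)))))

  hosted-count : ∀ v → count (Hosted v) ≡ capacity v
  hosted-count v = by-cases (a ≟ v) (r ≟ v)
    where
    by-cases : Dec (a ≡ v) → Dec (r ≡ v) → count (Hosted v) ≡ capacity v
    by-cases (yes a≡v) _         = subst (λ u → count (Hosted u) ≡ capacity u) a≡v hosted-by-a
    by-cases (no  _)   (yes r≡v) = subst (λ u → count (Hosted u) ≡ capacity u) r≡v hosted-by-r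
    by-cases (no  a≢v) (no  r≢v) = hosted-by-interior v a≢v r≢v

  open Caterpillar U two-inner host host-inner public
    using (caterpillar; isTree; degree-caterpillar; tree-on-⊇; a≁r; ¬star-long-spine; ¬star-leaf; ¬star-two-leaves)

  realizes : Realizes caterpillar d
  realizes v = begin
    degree caterpillar v             ≡⟨ degree-caterpillar v ⟩
    skeleton v + count (L ∩ᵇ (⁅ v ⁆ᵇ ∘ host)) ≡⟨ cong (skeleton v +_) (hosted-count v) ⟩
    skeleton v + (d v ∸ skeleton v)  ≡⟨ m+[n∸m]≡n (skeleton≤d v) ⟩
    d v                              ∎
    where open ≡-Reasoning

  S : Fin (m ∸ 1) → Subset n
  S j = innerSet d ∪ Vs j

  U⊆S : ∀ j x → T (U x) → x ∈ S j
  U⊆S j x = x∈p∪q⁺ ∘ inj₁ ∘ U⊆innerSet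

  Vs⊆S : ∀ j {x} → x ∈ Vs j → x ∈ S j
  Vs⊆S j = x∈p∪q⁺ ∘ inj₂

  rep₁-hosted-by-a : count U ≡ 2 → ∀ j → T (Ba (rep₁ j))
  rep₁-hosted-by-a k≡2 j = Ba-takes-R XaR≤ca (rep₁ j) (∩ᵇ⁺ rep₁∈Xa (image⁺ j))
    where
    XaR≤ca : count (Xa ∩ᵇ R) ≤ ca
    XaR≤ca = ≤-trans (count-mono (Xa ∩ᵇ R) R (λ _ → ∩ᵇ⁻ʳ))
               (≤-trans (count-image rep₁) (m∸1≤ (proj₁ (spine₂⇒m≤ends k≡2)) ca+1≡da))
    rep₁∈Xa = L─Q⊆Xa (rep₁ j) (R⊆L (rep₁ j) (image⁺ j)) (R∩Q≡∅ (rep₁ j) (image⁺ j))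

  rep₂-hosted-by-r : count U ≡ 2 → ∀ j → T (Br (rep₂ j))
  rep₂-hosted-by-r k≡2 j = by-block (leaf-blocks (rep₂ j) (Q⊆L (rep₂ j) (image⁺ j)))
    where
    by-block : T (Ba (rep₂ j)) ⊎ T (Br (rep₂ j)) ⊎ T (X₃ (rep₂ j)) → T (Br (rep₂ j))
    by-block (inj₁ ba)        = ⊥-elim (Xa-avoids-Q k≡2 (rep₂ j) (Ba⊆Xa (rep₂ j) ba) (image⁺ j))
    by-block (inj₂ (inj₁ br)) = br
    by-block (inj₂ (inj₂ x₃)) = ⊥-elim (1+n≰n (subst (1 ≤_) (trans count-X₃ (spine₂⇒Σinterior-capacity≡0 k≡2)) (count-positive X₃ x₃)))

  -- If a is offered more of R than it can take, it takes only elements of R and the rest of R fits at r.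
  rep₁-hosted-by-ends : count U ≡ 3 → ∀ j → T (Ba (rep₁ j)) ⊎ T (Br (rep₁ j))
  rep₁-hosted-by-ends k≡3 j = by-cases (T? (Ba (rep₁ j))) (count (Xa ∩ᵇ R) ≤? ca)
    where
    rep₁∈L = R⊆L (rep₁ j) (image⁺ j)
    k≢2 : ¬ count U ≡ 2
    k≢2 k≡2 = 3≢2 (trans (sym k≡3) k≡2)
      where
      3≢2 : ¬ 3 ≡ 2
      3≢2 ()
    by-cases : Dec (T (Ba (rep₁ j))) → Dec (count (Xa ∩ᵇ R) ≤ ca) → T (Ba (rep₁ j)) ⊎ T (Br (rep₁ j))
    by-cases (yes ba) _ = inj₁ ba
    by-cases (no ¬ba) (yes XaR≤ca) = ⊥-elim (¬ba (Ba-takes-R XaR≤ca (rep₁ j) (∩ᵇ⁺ (L⊆Xa k≢2 (rep₁ j) rep₁∈L) (image⁺ j))))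
    by-cases (no ¬ba) (no XaR≰ca) = inj₂ (Br-takes-R XrR≤cr (rep₁ j) (∩ᵇ⁺ (─ᵇ⁺ rep₁∈L ¬ba) (image⁺ j)))
      where
      Ba⊆R = Ba-only-R (<⇒≤ (≰⇒> XaR≰ca))
      XrR≤cr : count (Xr ∩ᵇ R) ≤ cr
      XrR≤cr = +-cancelˡ-≤ ca (count (Xr ∩ᵇ R)) cr (begin
        ca + count (Xr ∩ᵇ R)       ≤⟨ +-monoʳ-≤ ca (count-mono (Xr ∩ᵇ R) (R ─ᵇ Ba) (λ x p → ─ᵇ⁺ (∩ᵇ⁻ʳ p) (─ᵇ⁻ʳ (∩ᵇ⁻ˡ p)))) ⟩
        ca + count (R ─ᵇ Ba)       ≡⟨ cong (_+ count (R ─ᵇ Ba)) ∣Ba∣ ⟨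
        count Ba + count (R ─ᵇ Ba) ≡⟨ count-─ᵇ R Ba Ba⊆R ⟨
        count R                    ≤⟨ count-image rep₁ ⟩
        m ∸ 1                      ≤⟨ spine₃⇒m∸1≤ca+cr k≡3 ⟩
        ca + cr                    ∎)
        where open ≤-Reasoning

  not-star-spine₂ : count U ≡ 2 → ∀ j → ¬ IsStarOn caterpillar (S j)
  not-star-spine₂ k≡2 j =
    ¬star-two-leaves (S j) (rep₁ j) (rep₂ j) (Vs⊆S j (rep₁∈Vs j)) (Vs⊆S j (rep₂∈Vs j))
      (Vs-leaf j (rep₁∈Vs j)) (Vs-leaf j (rep₂∈Vs j))
      (λ hosts≡ → a≢r (trans (sym (host-Ba _ (rep₁-hosted-by-a k≡2 j))) (trans hosts≡ (host-Br _ (rep₂-hosted-by-r k≡2 j)))))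

  not-star-spine₃ : count U ≡ 3 → ∀ j → ¬ IsStarOn caterpillar (S j)
  not-star-spine₃ k≡3 j = by-end (rep₁-hosted-by-ends k≡3 j)
    where
    a≁r′ = a≁r (≤-reflexive (sym k≡3))
    rep₁∈S = Vs⊆S j (rep₁∈Vs j)
    rep₁-leaf = Vs-leaf j (rep₁∈Vs j)
    by-end : T (Ba (rep₁ j)) ⊎ T (Br (rep₁ j)) → ¬ IsStarOn caterpillar (S j)
    by-end (inj₁ ba) = ¬star-leaf (S j) (rep₁ j) r rep₁∈S (U⊆S j r r-inner) rep₁-leaf r-inner
      (a≢r ∘ trans (sym (host-Ba _ ba)))
      (a≁r′ ∘ subst (λ z → Adj caterpillar z r) (host-Ba _ ba))
    by-end (inj₂ br) = ¬star-leaf (S j) (rep₁ j) a rep₁∈S (U⊆S j a a-inner) rep₁-leaf a-inner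
      (a≢r ∘ sym ∘ trans (sym (host-Br _ br)))
      (a≁r′ ∘ Adj-sym caterpillar ∘ subst (λ z → Adj caterpillar z a) (host-Br _ br))

  not-star : ∀ j → ¬ IsStarOn caterpillar (S j)
  not-star j = by-cases (count U ℕ.≟ 2) (count U ℕ.≟ 3)
    where
    by-cases : Dec (count U ≡ 2) → Dec (count U ≡ 3) → ¬ IsStarOn caterpillar (S j)
    by-cases (yes k≡2) _         = not-star-spine₂ k≡2 j
    by-cases (no  _)   (yes k≡3) = not-star-spine₃ k≡3 j
    by-cases (no  k≢2) (no  k≢3) = ¬star-long-spine (≤∧≢⇒< (≤∧≢⇒< two-inner (k≢2 ∘ sym)) (k≢3 ∘ sym)) (S j) (U⊆S j)

mainTheorem8 : (n m : ℕ) (d : Fin n → ℕ) → IsTreeDegreeSeq d →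
    2 < m → m < n →
    (Vs : Fin (m ∸ 1) → Subset n) →
    (∀ j → Vs j ⊆ leafSet d) →
    (∀ j k → ¬ (j ≡ k) → Empty (Vs j ∩ Vs k)) →
    1 < ∣ innerSet d ∣ →
    (∀ j → 1 < ∣ Vs j ∣) →
    (∀ i → d i ≤ n ∸ m) →
    Σ (SimpleGraph n) λ T → IsTree T × Realizes T d ×
      (∀ j → IsTreeOn T (innerSet d ∪ Vs j) × ¬ IsStarOn T (innerSet d ∪ Vs j))
mainTheorem8 n m d tree-degrees _ m<n Vs Vs⊆L Vs-disjoint 1<∣U∣ 1<∣Vs∣ d≤n∸m =
  caterpillar , isTree , realizes , λ j → tree-on-⊇ (S j) (U⊆S j) , not-star j
  where open Construction n m d tree-degrees m<n Vs Vs⊆L Vs-disjoint 1<∣U∣ 1<∣Vs∣ d≤n∸m
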